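{- There is an absolute constant $c$ such that for every access sequence $S\in[n]^m$ and any two quantities $F,G\in\{\mathit{WB}(S),\mathit{SO}(S),\mathit{WSF}(S),\mathit{FF}(S)\}$, we have $F\le c\,(G+m)$. That is, the weighted balance, static optimality, weighted static finger and fixed finger bounds are equal up to constant factors (and an additive $O(m)$ term).
   Context: Logarithms are base 2. $S=(s_1,\dots,s_m)\in[n]^m$. A weight function is $w:[n]\to\mathbb R_{>0}$; $W=\sum_{i=1}^n w(i)$ and $w[a:b]=\sum_{i=\min(a,b)}^{\max(a,b)}w(i)$. Weighted balance: $\mathit{WB}(S)=\inf_w\sum_{j=1}^m\log\frac{W}{w(s_j)}$. Static optimality: $\mathit{SO}(S)=\min_T\sum_{j=1}^m d_T(s_j)$ over BSTs $T$ on $[n]$, where $d_T(x)$ is the depth of $x$ (root has depth $0$). Weighted static finger: $\mathit{WSF}(S)=\inf_{w,f}\sum_{j=1}^m\log\frac{w[f:s_j]}{\min\{w(f),w(s_j)\}}$ over weight functions $w$ and keys $f\in[n]$. Fixed finger: $\mathit{FF}(S)=\min_{T,f}\sum_{j=1}^m d_T(f,s_j)$ over BSTs $T$ on $[n]$ and keys $f$, where $d_T(f,x)$ is the number of edges on the $f$–$x$ path in $T$.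
   Formalization: The weight functions in the weighted balance and weighted static finger bounds take positive rational values instead of values in $\mathbb R_{>0}$. -}

module Defs where

open import Data.Nat as ℕ using (ℕ; zero; suc; _<ᵇ_; _≡ᵇ_; _⊓_; _⊔_; _≤ᵇ_)
open import Data.Bool using (Bool; true; false; if_then_else_; _∧_)
open import Data.Fin using (Fin; toℕ)
open import Data.Fin.Base using () renaming (_≤_ to _≤F_)
open import Data.List using (List; []; _∷_; foldr; map; filter)
open import Data.List.Base using (allFin)
open import Data.Vec using (Vec; toList)
open import Data.Product using (_×_; _,_; Σ; ∃; ∃-syntax)
open import Data.Integer using (+_)
open import Data.Rational as Q using (ℚ; 0ℚ; 1ℚ; _+_; _*_)
open import Relation.Nullary using (Dec)

sumℚ : List ℚ → ℚ
sumℚ = foldr _+_ 0ℚ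

prodℚ : List ℚ → ℚ
prodℚ = foldr _*_ 1ℚ

powℚ : ℚ → ℕ → ℚ
powℚ q zero    = 1ℚ
powℚ q (suc k) = q * powℚ q k

ℕtoℚ : ℕ → ℚ
ℕtoℚ k = + k Q./ 1

sumℕ : List ℕ → ℕ
sumℕ = foldr ℕ._+_ 0

record Weight (n : ℕ) : Set where
  field
    w   : Fin n → ℚ
    pos : ∀ i → 0ℚ Q.< w i
open Weight public

totalW : ∀ {n} → Weight n → ℚ
totalW {n} ω = sumℚ (map (w ω) (allFin n))

inRange : ∀ {n} → Fin n → Fin n → Fin n → Bool
inRange a b i = ((toℕ a ⊓ toℕ b) ≤ᵇ toℕ i) ∧ (toℕ i ≤ᵇ (toℕ a ⊔ toℕ b))

intervalW : ∀ {n} → Weight n → Fin n → Fin n → ℚ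
intervalW {n} ω a b = sumℚ (map (w ω) (filterB (inRange a b) (allFin n)))
  where
  filterB : {A : Set} → (A → Bool) → List A → List A
  filterB p []       = []
  filterB p (x ∷ xs) = if p x then x ∷ filterB p xs else filterB p xs

-- Binary search trees.  BST lo hi is a BST whose key set is exactly
-- {lo, …, hi-1}; BSTs on [n] are BST 0 n (key i ∈ Fin n ↦ toℕ i).

data BST : ℕ → ℕ → Set where
  empty : ∀ {k} → BST k k
  node  : ∀ {lo hi} (k : ℕ) → BST lo k → BST (suc k) hi → BST lo hi

-- depth of key x (root has depth 0); only meaningful for keys of the tree
depth : ∀ {lo hi} → BST lo hi → ℕ → ℕ
depth empty          x = 0
depth (node k l r)   x =
  if x ≡ᵇ k then 0
  else if x <ᵇ k then suc (depth l x)
  else suc (depth r x)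

dist : ∀ {lo hi} → BST lo hi → ℕ → ℕ → ℕ
dist empty        f x = 0
dist (node k l r) f x =
  if (f <ᵇ k) ∧ (x <ᵇ k) then dist l f x
  else if (k <ᵇ f) ∧ (k <ᵇ x) then dist r f x
  else depth (node k l r) f ℕ.+ depth (node k l r) x

-- Each bound B(S) is an infimum/minimum over a set of witnesses of a cost
-- of the form  log₂ (num / den)  with num, den > 0 rationals.  We record the
-- witnesses and (num, den), i.e. 2^{cost} = num/den, avoiding real logs.

record Bound : Set₁ where
  field
    Wit : Set
    num : Wit → ℚ
    den : Wit → ℚ
open Bound public

module _ {n m : ℕ} (S : Vec (Fin n) m) where
  private
    Sl : List (Fin n)
    Sl = toList S

  -- WB(S) = inf_w Σ_j log (W / w(s_j));  2^{cost} = W^m / Π_j w(s_j)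
  WB : Bound
  WB = record
    { Wit = Weight n
    ; num = λ ω → powℚ (totalW ω) m
    ; den = λ ω → prodℚ (map (w ω) Sl) }

  SO : Bound
  SO = record
    { Wit = BST 0 n
    ; num = λ T → powℚ (ℕtoℚ 2) (sumℕ (map (λ s → depth T (toℕ s)) Sl))
    ; den = λ _ → 1ℚ }

  WSF : Bound
  WSF = record
    { Wit = Weight n × Fin n
    ; num = λ { (ω , f) → prodℚ (map (intervalW ω f) Sl) }
    ; den = λ { (ω , f) → prodℚ (map (λ s → w ω f Q.⊓ w ω s) Sl) } }

  FF : Bound
  FF = record
    { Wit = BST 0 n × Fin n
    ; num = λ { (T , f) → powℚ (ℕtoℚ 2) (sumℕ (map (λ s → dist T (toℕ f) (toℕ s)) Sl)) }
    ; den = λ _ → 1ℚ }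

data BoundName : Set where
  wb so wsf ff : BoundName

bound : BoundName → ∀ {n m} → Vec (Fin n) m → Bound
bound wb  S = WB S
bound so  S = SO S
bound wsf S = WSF S
bound ff  S = FF S

-- F ≤ c (G + m), where F = inf_f log(numF f / denF f), G = inf_g log(...):
-- for every witness g of G and every δ > 1 (i.e. every slack ε = log δ > 0)
-- there is a witness f of F with
--    log(numF f/denF f) ≤ c·(log(numG g/denG g) + m) + log δ,
-- written multiplicatively (all quantities positive):
--    numF f · (denG g)^c ≤ δ · 2^{c·m} · (numG g)^c · denF f.

_≤[_,_]_ : Bound → ℕ → ℕ → Bound → Set
F ≤[ c , m ] G =
  ∀ (g : Wit G) (δ : ℚ) → 1ℚ Q.< δ →
  ∃[ f ] (num F f * powℚ (den G g) c
          Q.≤ δ * powℚ (ℕtoℚ 2) (c ℕ.* m) * powℚ (num G g) c * den F f)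

{-# OPTIONS --safe #-}
-- Every cost is compared with WB, and since all four bounds are products over the accesses it
-- suffices to compare them factor by factor.  SO ≤ WB: a weight-balanced tree puts every key x at
-- a depth with 2^depth(x) · w(x) ≤ W.  FF ≤ SO: put the finger at the root.  WSF ≤ WB: put the
-- finger at a heaviest key, so that min(w(f), w(s)) = w(s) and w[f:s] ≤ W.  WB ≤ 2 (FF + m): weigh
-- each key x by 4^-d(f,x); a Kraft-type inequality bounds the total weight by 5/2.
-- WB ≤ 2 (WSF + m): weigh x by w(f) w(x) / w[f:x]²; on either side of f these weights telescope
-- to at most 1, so the total is at most 3, while W / w'(s) ≤ 4 (w[f:s] / min(w(f), w(s)))².
-- Composing through WB then gives F ≤ 2 (G + m) for every pair.
module Submission where

open import Defs
open import Data.Bool using (Bool; true; false; if_then_else_; _∧_)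
open import Data.Bool.Properties using (∧-zeroʳ)
open import Data.Empty using (⊥-elim)
open import Data.Fin as Fin using (Fin; toℕ; fromℕ<)
import Data.Fin.Properties as Fin
import Data.Integer as ℤ
open import Data.List as List using (List; []; _∷_; map; length; allFin; filterᵇ)
import Data.List.Membership.Propositional.Properties as List
import Data.List.Properties as List
import Data.List.Relation.Unary.All as All
open import Data.Nat as ℕ using (ℕ; zero; suc; _≤_; _<_; z≤n; s≤s; _⊓_; _⊔_; _≤ᵇ_)
import Data.Nat.Properties as ℕ
open import Data.Product using (_×_; _,_; Σ; ∃-syntax; proj₁; proj₂)
open import Data.Rational as ℚ using (ℚ; 0ℚ; 1ℚ; _+_; _*_; _-_)
import Data.Rational.Properties as ℚ
open import Data.Rational.Solver using (module +-*-Solver)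
open import Data.Sum using (inj₁; inj₂)
open import Data.Vec using (Vec; toList)
import Data.Vec.Properties as Vec
open import Function using (_∘_)
open import Relation.Binary.Bundles using (DecTotalOrder)
open import Relation.Binary.Definitions using (tri<; tri≈; tri>)
open import Relation.Binary.PropositionalEquality
open import Relation.Nullary using (yes; no)
open import Relation.Nullary.Decidable using (dec-true; dec-false; toWitness)

open import Data.List.Extrema (DecTotalOrder.totalOrder ℚ.≤-decTotalOrder) using (argmax; f[xs]≤f[argmax])

open +-*-Solver

private
  variable
    p q r s : ℚ

2ℚ ¼ ½ : ℚ
2ℚ = ℕtoℚ 2
¼ = ℤ.+ 1 ℚ./ 4
½ = ℤ.+ 1 ℚ./ 2

0≤2ℚ : 0ℚ ℚ.≤ 2ℚ
0≤2ℚ = ℚ.<⇒≤ (ℚ.positive⁻¹ 2ℚ)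

0≤¼ : 0ℚ ℚ.≤ ¼
0≤¼ = ℚ.<⇒≤ (ℚ.positive⁻¹ ¼)

0≤1 : 0ℚ ℚ.≤ 1ℚ
0≤1 = ℚ.<⇒≤ (ℚ.positive⁻¹ 1ℚ)

*-monoˡ-≤-0≤ : 0ℚ ℚ.≤ r → p ℚ.≤ q → r * p ℚ.≤ r * q
*-monoˡ-≤-0≤ {r} 0≤r = ℚ.*-monoˡ-≤-nonNeg r {{ℚ.nonNegative 0≤r}}

*-monoʳ-≤-0≤ : 0ℚ ℚ.≤ r → p ℚ.≤ q → p * r ℚ.≤ q * r
*-monoʳ-≤-0≤ {r} 0≤r = ℚ.*-monoʳ-≤-nonNeg r {{ℚ.nonNegative 0≤r}}

*-mono-≤-0≤ : 0ℚ ℚ.≤ q → 0ℚ ℚ.≤ r → p ℚ.≤ q → r ℚ.≤ s → p * r ℚ.≤ q * s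
*-mono-≤-0≤ 0≤q 0≤r p≤q r≤s = ℚ.≤-trans (*-monoʳ-≤-0≤ 0≤r p≤q) (*-monoˡ-≤-0≤ 0≤q r≤s)

*-nonNeg : 0ℚ ℚ.≤ p → 0ℚ ℚ.≤ q → 0ℚ ℚ.≤ p * q
*-nonNeg {p} {q} 0≤p 0≤q = ℚ.nonNegative⁻¹ (p * q)
  {{ℚ.nonNeg*nonNeg⇒nonNeg p {{ℚ.nonNegative 0≤p}} q {{ℚ.nonNegative 0≤q}}}}

*-pos : 0ℚ ℚ.< p → 0ℚ ℚ.< q → 0ℚ ℚ.< p * q
*-pos {p} {q} 0<p 0<q = ℚ.positive⁻¹ (p * q)
  {{ℚ.pos*pos⇒pos p {{ℚ.positive 0<p}} q {{ℚ.positive 0<q}}}}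

+-pos : 0ℚ ℚ.< p → 0ℚ ℚ.≤ q → 0ℚ ℚ.< p + q
+-pos = ℚ.+-mono-<-≤

⊓-pos : 0ℚ ℚ.< p → 0ℚ ℚ.< q → 0ℚ ℚ.< p ℚ.⊓ q
⊓-pos {p} {q} 0<p 0<q with ℚ.⊓-sel p q
... | inj₁ p⊓q≡p = subst (0ℚ ℚ.<_) (sym p⊓q≡p) 0<p
... | inj₂ p⊓q≡q = subst (0ℚ ℚ.<_) (sym p⊓q≡q) 0<q

p≤p+q : 0ℚ ℚ.≤ q → p ℚ.≤ p + q
p≤p+q {q} {p} 0≤q = ℚ.≤-trans (ℚ.≤-reflexive (sym (ℚ.+-identityʳ p))) (ℚ.+-monoʳ-≤ p 0≤q)

q≤p+q : 0ℚ ℚ.≤ p → q ℚ.≤ p + q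
q≤p+q {p} {q} 0≤p = ℚ.≤-trans (ℚ.≤-reflexive (sym (ℚ.+-identityˡ q))) (ℚ.+-monoˡ-≤ q 0≤p)

infixl 8 _²
_² : ℚ → ℚ
p ² = p * p

-- A total inverse, with junk value inv₀ p = 0 for p ≤ 0.
inv₀ : ℚ → ℚ
inv₀ p with p ℚ.≤? 0ℚ
... | yes _   = 0ℚ
... | no p≰0 = (ℚ.1/ p) {{ℚ.pos⇒nonZero p {{ℚ.positive (ℚ.≰⇒> p≰0)}}}}

*-inv₀ : 0ℚ ℚ.< p → p * inv₀ p ≡ 1ℚ
*-inv₀ {p} 0<p with p ℚ.≤? 0ℚ
... | yes p≤0 = ⊥-elim (ℚ.<-irrefl refl (ℚ.<-≤-trans 0<p p≤0))
... | no p≰0 = ℚ.*-inverseʳ p {{ℚ.pos⇒nonZero p {{ℚ.positive (ℚ.≰⇒> p≰0)}}}}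

inv₀-nonNeg : ∀ p → 0ℚ ℚ.≤ inv₀ p
inv₀-nonNeg p with p ℚ.≤? 0ℚ
... | yes _   = ℚ.≤-refl
... | no p≰0 = ℚ.<⇒≤ (ℚ.positive⁻¹ _ {{ℚ.1/pos⇒pos p {{ℚ.positive (ℚ.≰⇒> p≰0)}}}})

inv₀-pos : 0ℚ ℚ.< p → 0ℚ ℚ.< inv₀ p
inv₀-pos {p} 0<p with p ℚ.≤? 0ℚ
... | yes p≤0 = ⊥-elim (ℚ.<-irrefl refl (ℚ.<-≤-trans 0<p p≤0))
... | no p≰0 = ℚ.positive⁻¹ _ {{ℚ.1/pos⇒pos p {{ℚ.positive (ℚ.≰⇒> p≰0)}}}}

inv₀-antimono : 0ℚ ℚ.< p → p ℚ.≤ q → inv₀ q ℚ.≤ inv₀ p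
inv₀-antimono {p} {q} 0<p p≤q = begin
  inv₀ q                   ≡⟨ sym (ℚ.*-identityʳ (inv₀ q)) ⟩
  inv₀ q * 1ℚ              ≡⟨ cong (inv₀ q *_) (sym (*-inv₀ 0<p)) ⟩
  inv₀ q * (p * inv₀ p)    ≤⟨ *-monoˡ-≤-0≤ (inv₀-nonNeg q) (*-monoʳ-≤-0≤ (inv₀-nonNeg p) p≤q) ⟩
  inv₀ q * (q * inv₀ p)    ≡⟨ solve 3 (λ x y z → x :* (y :* z) := (y :* x) :* z) refl (inv₀ q) q (inv₀ p) ⟩
  (q * inv₀ q) * inv₀ p    ≡⟨ cong (_* inv₀ p) (*-inv₀ (ℚ.<-≤-trans 0<p p≤q)) ⟩
  1ℚ * inv₀ p              ≡⟨ ℚ.*-identityˡ (inv₀ p) ⟩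
  inv₀ p                   ∎
  where open ℚ.≤-Reasoning

pow-+ : ∀ q a b → powℚ q (a ℕ.+ b) ≡ powℚ q a * powℚ q b
pow-+ q zero    b = sym (ℚ.*-identityˡ _)
pow-+ q (suc a) b = trans (cong (q *_) (pow-+ q a b)) (sym (ℚ.*-assoc q _ _))

pow-* : ∀ q a b → powℚ q (a ℕ.* b) ≡ powℚ (powℚ q a) b
pow-* q a zero    = cong (powℚ q) (ℕ.*-zeroʳ a)
pow-* q a (suc b) = begin
  powℚ q (a ℕ.* suc b)              ≡⟨ cong (powℚ q) (ℕ.*-suc a b) ⟩
  powℚ q (a ℕ.+ a ℕ.* b)            ≡⟨ pow-+ q a (a ℕ.* b) ⟩
  powℚ q a * powℚ q (a ℕ.* b)       ≡⟨ cong (powℚ q a *_) (pow-* q a b) ⟩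
  powℚ q a * powℚ (powℚ q a) b      ∎
  where open ≡-Reasoning

pow-distrib-* : ∀ p q c → powℚ (p * q) c ≡ powℚ p c * powℚ q c
pow-distrib-* p q zero    = refl
pow-distrib-* p q (suc c) = trans (cong ((p * q) *_) (pow-distrib-* p q c))
  (solve 4 (λ p q x y → (p :* q) :* (x :* y) := (p :* x) :* (q :* y)) refl p q (powℚ p c) (powℚ q c))

pow-1 : ∀ c → powℚ 1ℚ c ≡ 1ℚ
pow-1 zero    = refl
pow-1 (suc c) = cong (1ℚ *_) (pow-1 c)

pow-nonNeg : ∀ c → 0ℚ ℚ.≤ p → 0ℚ ℚ.≤ powℚ p c
pow-nonNeg zero    0≤p = 0≤1
pow-nonNeg (suc c) 0≤p = *-nonNeg 0≤p (pow-nonNeg c 0≤p)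

pow-pos : ∀ c → 0ℚ ℚ.< p → 0ℚ ℚ.< powℚ p c
pow-pos zero    0<p = ℚ.positive⁻¹ 1ℚ
pow-pos (suc c) 0<p = *-pos 0<p (pow-pos c 0<p)

pow-mono-≤ : ∀ c → 0ℚ ℚ.≤ p → p ℚ.≤ q → powℚ p c ℚ.≤ powℚ q c
pow-mono-≤ zero    0≤p p≤q = ℚ.≤-refl
pow-mono-≤ (suc c) 0≤p p≤q =
  *-mono-≤-0≤ (ℚ.≤-trans 0≤p p≤q) (pow-nonNeg c 0≤p) p≤q (pow-mono-≤ c 0≤p p≤q)

pow-mono-≤-* : ∀ k {a b c d} → 0ℚ ℚ.≤ a → 0ℚ ℚ.≤ b → a * b ℚ.≤ c * d → powℚ a k * powℚ b k ℚ.≤ powℚ c k * powℚ d k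
pow-mono-≤-* k {a} {b} {c} {d} 0≤a 0≤b ab≤cd = begin
  powℚ a k * powℚ b k  ≡⟨ sym (pow-distrib-* a b k) ⟩
  powℚ (a * b) k       ≤⟨ pow-mono-≤ k (*-nonNeg 0≤a 0≤b) ab≤cd ⟩
  powℚ (c * d) k       ≡⟨ pow-distrib-* c d k ⟩
  powℚ c k * powℚ d k  ∎
  where open ℚ.≤-Reasoning

pow-2²-¼ : ∀ d → powℚ (powℚ 2ℚ d) 2 * powℚ ¼ d ≡ 1ℚ
pow-2²-¼ d = begin
  powℚ (powℚ 2ℚ d) 2 * powℚ ¼ d    ≡⟨ cong (_* powℚ ¼ d) (trans (cong (powℚ 2ℚ d *_) (ℚ.*-identityʳ _)) (sym (pow-distrib-* 2ℚ 2ℚ d))) ⟩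
  powℚ (2ℚ * 2ℚ) d * powℚ ¼ d      ≡⟨ sym (pow-distrib-* (2ℚ * 2ℚ) ¼ d) ⟩
  powℚ 1ℚ d                        ≡⟨ pow-1 d ⟩
  1ℚ                               ∎
  where open ≡-Reasoning

module _ {A : Set} where

  Π : (A → ℚ) → List A → ℚ
  Π a xs = prodℚ (map a xs)

  Π-* : ∀ (a b : A → ℚ) xs → Π (λ x → a x * b x) xs ≡ Π a xs * Π b xs
  Π-* a b []       = refl
  Π-* a b (x ∷ xs) = trans (cong (a x * b x *_) (Π-* a b xs))
    (solve 4 (λ p q r s → (p :* q) :* (r :* s) := (p :* r) :* (q :* s)) refl (a x) (b x) (Π a xs) (Π b xs))

  Π-const : ∀ c (xs : List A) → Π (λ _ → c) xs ≡ powℚ c (length xs)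
  Π-const c []       = refl
  Π-const c (x ∷ xs) = cong (c *_) (Π-const c xs)

  Π-pow : ∀ (a : A → ℚ) c xs → powℚ (Π a xs) c ≡ Π (λ x → powℚ (a x) c) xs
  Π-pow a c []       = pow-1 c
  Π-pow a c (x ∷ xs) = trans (pow-distrib-* (a x) (Π a xs) c) (cong (powℚ (a x) c *_) (Π-pow a c xs))

  pow-sumℕ : ∀ q (d : A → ℕ) xs → powℚ q (sumℕ (map d xs)) ≡ Π (λ x → powℚ q (d x)) xs
  pow-sumℕ q d []       = refl
  pow-sumℕ q d (x ∷ xs) = trans (pow-+ q (d x) _) (cong (powℚ q (d x) *_) (pow-sumℕ q d xs))

  Π-pos : ∀ (a : A → ℚ) → (∀ x → 0ℚ ℚ.< a x) → ∀ xs → 0ℚ ℚ.< Π a xs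
  Π-pos a 0<a []       = ℚ.positive⁻¹ 1ℚ
  Π-pos a 0<a (x ∷ xs) = *-pos (0<a x) (Π-pos a 0<a xs)

  Π-mono-≤ : ∀ (a b : A → ℚ) → (∀ x → 0ℚ ℚ.≤ a x) → (∀ x → a x ℚ.≤ b x) → ∀ xs → Π a xs ℚ.≤ Π b xs
  Π-mono-≤ a b 0≤a a≤b []       = ℚ.≤-refl
  Π-mono-≤ a b 0≤a a≤b (x ∷ xs) =
    *-mono-≤-0≤ (ℚ.≤-trans (0≤a x) (a≤b x)) (Π-nonNeg xs) (a≤b x) (Π-mono-≤ a b 0≤a a≤b xs)
    where
    Π-nonNeg : ∀ xs → 0ℚ ℚ.≤ Π a xs
    Π-nonNeg []       = 0≤1
    Π-nonNeg (x ∷ xs) = *-nonNeg (0≤a x) (Π-nonNeg xs)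

sumFrom : (ℕ → ℚ) → ℕ → ℕ → ℚ
sumFrom g lo zero    = 0ℚ
sumFrom g lo (suc k) = g lo + sumFrom g (suc lo) k

-- Σ_{lo ≤ i < hi} g i; it is 0 when hi ≤ lo because of truncated subtraction.
sumRange : (ℕ → ℚ) → ℕ → ℕ → ℚ
sumRange g lo hi = sumFrom g lo (hi ℕ.∸ lo)

module _ {g h : ℕ → ℚ} where

  sumFrom-cong : ∀ lo k → (∀ i → lo ≤ i → i < lo ℕ.+ k → g i ≡ h i) → sumFrom g lo k ≡ sumFrom h lo k
  sumFrom-cong lo zero    g≡h = refl
  sumFrom-cong lo (suc k) g≡h = cong₂ _+_
    (g≡h lo ℕ.≤-refl (ℕ.m<m+n lo (s≤s z≤n)))
    (sumFrom-cong (suc lo) k λ i lo<i i<lo+k →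
      g≡h i (ℕ.<⇒≤ lo<i) (subst (i <_) (sym (ℕ.+-suc lo k)) i<lo+k))

  sumRange-cong : ∀ lo hi → lo ≤ hi → (∀ i → lo ≤ i → i < hi → g i ≡ h i) → sumRange g lo hi ≡ sumRange h lo hi
  sumRange-cong lo hi lo≤hi g≡h = sumFrom-cong lo (hi ℕ.∸ lo) λ i lo≤i i<hi →
    g≡h i lo≤i (subst (i <_) (ℕ.m+[n∸m]≡n lo≤hi) i<hi)

module _ (g : ℕ → ℚ) where

  sumFrom-+ : ∀ lo a b → sumFrom g lo (a ℕ.+ b) ≡ sumFrom g lo a + sumFrom g (a ℕ.+ lo) b
  sumFrom-+ lo zero    b = sym (ℚ.+-identityˡ _)
  sumFrom-+ lo (suc a) b = begin
    g lo + sumFrom g (suc lo) (a ℕ.+ b)                          ≡⟨ cong (g lo +_) (sumFrom-+ (suc lo) a b) ⟩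
    g lo + (sumFrom g (suc lo) a + sumFrom g (a ℕ.+ suc lo) b)   ≡⟨ sym (ℚ.+-assoc (g lo) _ _) ⟩
    sumFrom g lo (suc a) + sumFrom g (a ℕ.+ suc lo) b           ≡⟨ cong (λ i → sumFrom g lo (suc a) + sumFrom g i b) (ℕ.+-suc a lo) ⟩
    sumFrom g lo (suc a) + sumFrom g (suc a ℕ.+ lo) b           ∎
    where open ≡-Reasoning

  sumFrom-snoc : ∀ lo k → sumFrom g lo (suc k) ≡ sumFrom g lo k + g (lo ℕ.+ k)
  sumFrom-snoc lo k = begin
    sumFrom g lo (suc k)                              ≡⟨ cong (sumFrom g lo) (ℕ.+-comm 1 k) ⟩
    sumFrom g lo (k ℕ.+ 1)                            ≡⟨ sumFrom-+ lo k 1 ⟩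
    sumFrom g lo k + (g (k ℕ.+ lo) + 0ℚ)              ≡⟨ cong (sumFrom g lo k +_) (ℚ.+-identityʳ _) ⟩
    sumFrom g lo k + g (k ℕ.+ lo)                     ≡⟨ cong (λ i → sumFrom g lo k + g i) (ℕ.+-comm k lo) ⟩
    sumFrom g lo k + g (lo ℕ.+ k)                     ∎
    where open ≡-Reasoning

  sumRange-empty : ∀ lo → sumRange g lo lo ≡ 0ℚ
  sumRange-empty lo = cong (sumFrom g lo) (ℕ.n∸n≡0 lo)

  sumRange-split : ∀ lo k hi → lo ≤ k → k ≤ hi → sumRange g lo hi ≡ sumRange g lo k + sumRange g k hi
  sumRange-split lo k hi lo≤k k≤hi = begin
    sumFrom g lo (hi ℕ.∸ lo)                                        ≡⟨ cong (sumFrom g lo) hi-lo≡ ⟩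
    sumFrom g lo ((k ℕ.∸ lo) ℕ.+ (hi ℕ.∸ k))                        ≡⟨ sumFrom-+ lo (k ℕ.∸ lo) (hi ℕ.∸ k) ⟩
    sumFrom g lo (k ℕ.∸ lo) + sumFrom g (k ℕ.∸ lo ℕ.+ lo) (hi ℕ.∸ k)
      ≡⟨ cong (λ i → sumRange g lo k + sumFrom g i (hi ℕ.∸ k)) (ℕ.m∸n+n≡m lo≤k) ⟩
    sumRange g lo k + sumRange g k hi                                ∎
    where
    open ≡-Reasoning
    hi-lo≡ : hi ℕ.∸ lo ≡ (k ℕ.∸ lo) ℕ.+ (hi ℕ.∸ k)
    hi-lo≡ = trans (cong (ℕ._∸ lo) (sym (ℕ.m+[n∸m]≡n k≤hi))) (ℕ.+-∸-comm (hi ℕ.∸ k) lo≤k)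

  sumRange-uncons : ∀ k hi → k < hi → sumRange g k hi ≡ g k + sumRange g (suc k) hi
  sumRange-uncons k hi k<hi = cong (sumFrom g k) (ℕ.+-∸-assoc 1 k<hi)

  sumRange-pick : ∀ lo k hi → lo ≤ k → k < hi → sumRange g lo hi ≡ sumRange g lo k + (g k + sumRange g (suc k) hi)
  sumRange-pick lo k hi lo≤k k<hi =
    trans (sumRange-split lo k hi lo≤k (ℕ.<⇒≤ k<hi)) (cong (sumRange g lo k +_) (sumRange-uncons k hi k<hi))

  sumRange-singleton : ∀ k → sumRange g k (suc k) ≡ g k
  sumRange-singleton k = trans (sumRange-uncons k (suc k) ℕ.≤-refl)
                               (trans (cong (g k +_) (sumRange-empty (suc k))) (ℚ.+-identityʳ (g k)))

  module _ (0≤g : ∀ i → 0ℚ ℚ.≤ g i) where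

    sumFrom-nonNeg : ∀ lo k → 0ℚ ℚ.≤ sumFrom g lo k
    sumFrom-nonNeg lo zero    = ℚ.≤-refl
    sumFrom-nonNeg lo (suc k) = ℚ.+-mono-≤ (0≤g lo) (sumFrom-nonNeg (suc lo) k)

    sumRange-nonNeg : ∀ lo hi → 0ℚ ℚ.≤ sumRange g lo hi
    sumRange-nonNeg lo hi = sumFrom-nonNeg lo (hi ℕ.∸ lo)

    term≤sumRange : ∀ lo k hi → lo ≤ k → k < hi → g k ℚ.≤ sumRange g lo hi
    term≤sumRange lo k hi lo≤k k<hi = begin
      g k                                               ≤⟨ p≤p+q (sumRange-nonNeg (suc k) hi) ⟩
      g k + sumRange g (suc k) hi                       ≤⟨ q≤p+q (sumRange-nonNeg lo k) ⟩
      sumRange g lo k + (g k + sumRange g (suc k) hi)   ≡⟨ sym (sumRange-pick lo k hi lo≤k k<hi) ⟩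
      sumRange g lo hi                                  ∎
      where open ℚ.≤-Reasoning

sumFrom-suc : ∀ (g : ℕ → ℚ) lo k → sumFrom g (suc lo) k ≡ sumFrom (g ∘ suc) lo k
sumFrom-suc g lo zero    = refl
sumFrom-suc g lo (suc k) = cong (g (suc lo) +_) (sumFrom-suc g (suc lo) k)

sumFrom-shift : ∀ (g : ℕ → ℚ) lo k → sumFrom g lo k ≡ sumFrom (λ t → g (lo ℕ.+ t)) 0 k
sumFrom-shift g zero     k = refl
sumFrom-shift g (suc lo) k = trans (sumFrom-suc g lo k) (sumFrom-shift (g ∘ suc) lo k)

sumFrom-reverse : ∀ (g : ℕ → ℚ) k → sumFrom g 0 k ≡ sumFrom (λ t → g (k ℕ.∸ suc t)) 0 k
sumFrom-reverse g zero    = refl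
sumFrom-reverse g (suc k) = begin
  sumFrom g 0 (suc k)                                  ≡⟨ sumFrom-snoc g 0 k ⟩
  sumFrom g 0 k + g k                                  ≡⟨ ℚ.+-comm _ (g k) ⟩
  g k + sumFrom g 0 k                                  ≡⟨ cong (g k +_) (sumFrom-reverse g k) ⟩
  g k + sumFrom (λ t → g (k ℕ.∸ suc t)) 0 k            ≡⟨ cong (g k +_) (sym (sumFrom-suc (λ t → g (suc k ℕ.∸ suc t)) 0 k)) ⟩
  sumFrom (λ t → g (suc k ℕ.∸ suc t)) 0 (suc k)       ∎
  where open ≡-Reasoning

*-distribˡ-sumFrom : ∀ c (g : ℕ → ℚ) lo k → c * sumFrom g lo k ≡ sumFrom (λ i → c * g i) lo k
*-distribˡ-sumFrom c g lo zero    = ℚ.*-zeroʳ c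
*-distribˡ-sumFrom c g lo (suc k) =
  trans (ℚ.*-distribˡ-+ c (g lo) _) (cong (c * g lo +_) (*-distribˡ-sumFrom c g (suc lo) k))

sumFrom-zeros : ∀ lo k → sumFrom (λ _ → 0ℚ) lo k ≡ 0ℚ
sumFrom-zeros lo zero    = refl
sumFrom-zeros lo (suc k) = trans (ℚ.+-identityˡ _) (sumFrom-zeros (suc lo) k)

extend : ∀ {n} → (Fin n → ℚ) → ℕ → ℚ
extend {zero}  h i       = 0ℚ
extend {suc n} h zero    = h Fin.zero
extend {suc n} h (suc i) = extend (h ∘ Fin.suc) i

extend-toℕ : ∀ {n} (h : Fin n → ℚ) x → extend h (toℕ x) ≡ h x
extend-toℕ h Fin.zero    = refl
extend-toℕ h (Fin.suc x) = extend-toℕ (h ∘ Fin.suc) x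

extend-nonNeg : ∀ {n} (h : Fin n → ℚ) → (∀ x → 0ℚ ℚ.≤ h x) → ∀ i → 0ℚ ℚ.≤ extend h i
extend-nonNeg {zero}  h 0≤h i       = ℚ.≤-refl
extend-nonNeg {suc n} h 0≤h zero    = 0≤h Fin.zero
extend-nonNeg {suc n} h 0≤h (suc i) = extend-nonNeg (h ∘ Fin.suc) (0≤h ∘ Fin.suc) i

sumℚ-allFin : ∀ n (h : ℕ → ℚ) → sumℚ (map (h ∘ toℕ) (allFin n)) ≡ sumFrom h 0 n
sumℚ-allFin zero    h = refl
sumℚ-allFin (suc n) h = cong (h 0 +_) (begin
  sumℚ (map (h ∘ toℕ) (List.tabulate {n = n} Fin.suc))  ≡⟨ cong sumℚ (List.map-tabulate {n = n} Fin.suc (h ∘ toℕ)) ⟩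
  sumℚ (List.tabulate {n = n} (h ∘ suc ∘ toℕ))          ≡⟨ cong sumℚ (sym (List.map-tabulate {n = n} (λ i → i) (h ∘ suc ∘ toℕ))) ⟩
  sumℚ (map (h ∘ suc ∘ toℕ) (allFin n))          ≡⟨ sumℚ-allFin n (h ∘ suc) ⟩
  sumFrom (h ∘ suc) 0 n                          ≡⟨ sym (sumFrom-suc h 0 n) ⟩
  sumFrom h 1 n                                  ∎)
  where open ≡-Reasoning

-- intervalW filters with a local copy of filterᵇ, which is identified here by its equations.
filterᵇ-unique : ∀ {A : Set} (p : A → Bool) (φ : List A → List A) → φ [] ≡ [] →
                 (∀ x xs → φ (x ∷ xs) ≡ (if p x then x ∷ φ xs else φ xs)) →
                 ∀ xs → φ xs ≡ filterᵇ p xs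
filterᵇ-unique p φ φ[] φ∷ []       = φ[]
filterᵇ-unique p φ φ[] φ∷ (x ∷ xs) rewrite φ∷ x xs with p x
... | true  = cong (x ∷_) (filterᵇ-unique p φ φ[] φ∷ xs)
... | false = filterᵇ-unique p φ φ[] φ∷ xs

module _ {A : Set} (h : A → ℚ) (p : A → Bool) where

  sumℚ-filterᵇ : ∀ xs → sumℚ (map h (filterᵇ p xs)) ≡ sumℚ (map (λ x → if p x then h x else 0ℚ) xs)
  sumℚ-filterᵇ []       = refl
  sumℚ-filterᵇ (x ∷ xs) with p x
  ... | true  = cong (h x +_) (sumℚ-filterᵇ xs)
  ... | false = trans (sumℚ-filterᵇ xs) (sym (ℚ.+-identityˡ _))

  sumℚ-filterᵇ-≤ : (∀ x → 0ℚ ℚ.≤ h x) → ∀ xs → sumℚ (map h (filterᵇ p xs)) ℚ.≤ sumℚ (map h xs)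
  sumℚ-filterᵇ-≤ 0≤h []       = ℚ.≤-refl
  sumℚ-filterᵇ-≤ 0≤h (x ∷ xs) with p x
  ... | true  = ℚ.+-monoʳ-≤ (h x) (sumℚ-filterᵇ-≤ 0≤h xs)
  ... | false = ℚ.≤-trans (sumℚ-filterᵇ-≤ 0≤h xs) (q≤p+q (0≤h x))

sumFrom-restrict : ∀ (g : ℕ → ℚ) lo hi n → lo ≤ hi → hi < n →
  sumFrom (λ i → if (lo ≤ᵇ i) ∧ (i ≤ᵇ hi) then g i else 0ℚ) 0 n ≡ sumRange g lo (suc hi)
sumFrom-restrict g lo hi n lo≤hi hi<n = begin
  sumRange g′ 0 n                                                  ≡⟨ sumRange-split g′ 0 lo n z≤n lo≤n ⟩
  sumRange g′ 0 lo + sumRange g′ lo n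
    ≡⟨ cong (sumRange g′ 0 lo +_) (sumRange-split g′ lo (suc hi) n lo≤1+hi hi<n) ⟩
  sumRange g′ 0 lo + (sumRange g′ lo (suc hi) + sumRange g′ (suc hi) n)
    ≡⟨ cong₂ (λ x y → x + (sumRange g′ lo (suc hi) + y)) below above ⟩
  0ℚ + (sumRange g′ lo (suc hi) + 0ℚ)                              ≡⟨ trans (ℚ.+-identityˡ _) (ℚ.+-identityʳ _) ⟩
  sumRange g′ lo (suc hi)                                          ≡⟨ sumRange-cong lo (suc hi) lo≤1+hi inside ⟩
  sumRange g lo (suc hi)                                           ∎
  where
  open ≡-Reasoning
  g′ : ℕ → ℚ
  g′ i = if (lo ≤ᵇ i) ∧ (i ≤ᵇ hi) then g i else 0ℚ
  lo≤1+hi = ℕ.m≤n⇒m≤1+n lo≤hi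
  lo≤n = ℕ.≤-trans lo≤1+hi hi<n
  inside : ∀ i → lo ≤ i → i < suc hi → g′ i ≡ g i
  inside i lo≤i i≤hi rewrite dec-true (lo ℕ.≤? i) lo≤i | dec-true (i ℕ.≤? hi) (ℕ.≤-pred i≤hi) = refl
  below : sumRange g′ 0 lo ≡ 0ℚ
  below = trans (sumRange-cong 0 lo z≤n (λ i _ i<lo → cong (λ b → if b ∧ (i ≤ᵇ hi) then g i else 0ℚ)
                   (dec-false (lo ℕ.≤? i) (ℕ.<⇒≱ i<lo))))
                (sumFrom-zeros 0 lo)
  above : sumRange g′ (suc hi) n ≡ 0ℚ
  above = trans (sumRange-cong (suc hi) n hi<n (λ i hi<i _ → cong (if_then g i else 0ℚ)
                   (trans (cong ((lo ≤ᵇ i) ∧_) (dec-false (i ℕ.≤? hi) (ℕ.<⇒≱ hi<i))) (∧-zeroʳ (lo ≤ᵇ i)))))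
                (sumFrom-zeros (suc hi) (n ℕ.∸ suc hi))

module _ {n : ℕ} (ω : Weight n) where

  private
    g : ℕ → ℚ
    g = extend (w ω)

  totalW≡sumFrom : totalW ω ≡ sumFrom g 0 n
  totalW≡sumFrom = trans (cong sumℚ (List.map-cong (λ x → sym (extend-toℕ (w ω) x)) (allFin n))) (sumℚ-allFin n g)

  extend-w-nonNeg : ∀ i → 0ℚ ℚ.≤ extend (w ω) i
  extend-w-nonNeg = extend-nonNeg (w ω) (λ x → ℚ.<⇒≤ (pos ω x))

  intervalW≡filterᵇ : ∀ a b → intervalW ω a b ≡ sumℚ (map (w ω) (filterᵇ (inRange a b) (allFin n)))
  -- Abstracting the fold and the map leaves intervalW's local filter as the only candidate for φ.
  intervalW≡filterᵇ a b with filterᵇ-unique (inRange a b) _ refl (λ _ _ → refl) | allFin n | List.foldr {A = ℚ} _+_ 0ℚ | map (w ω)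
  ... | φ≡filterᵇ | xs | Σ | mapw = cong (Σ ∘ mapw) (φ≡filterᵇ xs)

  intervalW≤totalW : ∀ a b → intervalW ω a b ℚ.≤ totalW ω
  intervalW≤totalW a b = ℚ.≤-trans (ℚ.≤-reflexive (intervalW≡filterᵇ a b))
    (sumℚ-filterᵇ-≤ (w ω) (inRange a b) (λ x → ℚ.<⇒≤ (pos ω x)) (allFin n))

  intervalW≡sumRange : ∀ a b → intervalW ω a b ≡ sumRange g (toℕ a ⊓ toℕ b) (suc (toℕ a ⊔ toℕ b))
  intervalW≡sumRange a b = begin
    intervalW ω a b                                                   ≡⟨ intervalW≡filterᵇ a b ⟩
    sumℚ (map (w ω) (filterᵇ (inRange a b) (allFin n)))               ≡⟨ sumℚ-filterᵇ (w ω) (inRange a b) (allFin n) ⟩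
    sumℚ (map (λ x → if inRange a b x then w ω x else 0ℚ) (allFin n))
      ≡⟨ cong sumℚ (List.map-cong (λ x → cong (if inRange a b x then_else 0ℚ) (sym (extend-toℕ (w ω) x))) (allFin n)) ⟩
    sumℚ (map (g′ ∘ toℕ) (allFin n))                                  ≡⟨ sumℚ-allFin n g′ ⟩
    sumFrom g′ 0 n
      ≡⟨ sumFrom-restrict g (toℕ a ⊓ toℕ b) (toℕ a ⊔ toℕ b) n (ℕ.m⊓n≤m⊔n (toℕ a) (toℕ b)) (ℕ.⊔-lub (Fin.toℕ<n a) (Fin.toℕ<n b)) ⟩
    sumRange g (toℕ a ⊓ toℕ b) (suc (toℕ a ⊔ toℕ b))                  ∎
    where
    open ≡-Reasoning
    g′ : ℕ → ℚ
    g′ i = if ((toℕ a ⊓ toℕ b) ≤ᵇ i) ∧ (i ≤ᵇ (toℕ a ⊔ toℕ b)) then g i else 0ℚ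

  w≤intervalW : ∀ a b → w ω a ℚ.≤ intervalW ω a b
  w≤intervalW a b = begin
    w ω a                                              ≡⟨ sym (extend-toℕ (w ω) a) ⟩
    g (toℕ a)
      ≤⟨ term≤sumRange g extend-w-nonNeg _ (toℕ a) _ (ℕ.m⊓n≤m (toℕ a) (toℕ b)) (s≤s (ℕ.m≤m⊔n (toℕ a) (toℕ b))) ⟩
    sumRange g (toℕ a ⊓ toℕ b) (suc (toℕ a ⊔ toℕ b))   ≡⟨ sym (intervalW≡sumRange a b) ⟩
    intervalW ω a b                                    ∎
    where open ℚ.≤-Reasoning

  intervalW-pos : ∀ a b → 0ℚ ℚ.< intervalW ω a b
  intervalW-pos a b = ℚ.<-≤-trans (pos ω a) (w≤intervalW a b)

  totalW-pos : Fin n → 0ℚ ℚ.< totalW ω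
  totalW-pos x = ℚ.<-≤-trans (intervalW-pos x x) (intervalW≤totalW x x)

lo≤hi : ∀ {lo hi} → BST lo hi → lo ≤ hi
lo≤hi empty        = ℕ.≤-refl
lo≤hi (node k l r) = ℕ.≤-trans (lo≤hi l) (ℕ.<⇒≤ (lo≤hi r))

module _ {lo hi : ℕ} (k : ℕ) (l : BST lo k) (r : BST (suc k) hi) where

  depth-root : depth (node k l r) k ≡ 0
  depth-root rewrite dec-true (k ℕ.≟ k) refl = refl

  depth-left : ∀ {x} → x < k → depth (node k l r) x ≡ suc (depth l x)
  depth-left {x} x<k rewrite dec-false (x ℕ.≟ k) (ℕ.<⇒≢ x<k) | dec-true (x ℕ.<? k) x<k = refl

  depth-right : ∀ {x} → k < x → depth (node k l r) x ≡ suc (depth r x)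
  depth-right {x} k<x rewrite dec-false (x ℕ.≟ k) (ℕ.>⇒≢ k<x) | dec-false (x ℕ.<? k) (ℕ.<⇒≯ k<x) = refl

  dist-root : ∀ x → dist (node k l r) k x ≡ depth (node k l r) x
  dist-root x rewrite dec-false (k ℕ.<? k) (ℕ.n≮n k) | dec-true (k ℕ.≟ k) refl = refl

  dist-left : ∀ {f x} → f < k → x < k → dist (node k l r) f x ≡ dist l f x
  dist-left {f} {x} f<k x<k rewrite dec-true (f ℕ.<? k) f<k | dec-true (x ℕ.<? k) x<k = refl

  dist-right : ∀ {f x} → k < f → k < x → dist (node k l r) f x ≡ dist r f x
  dist-right {f} {x} k<f k<x
    rewrite dec-false (f ℕ.<? k) (ℕ.<⇒≯ k<f) | dec-true (k ℕ.<? f) k<f | dec-true (k ℕ.<? x) k<x = refl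

  dist-left-across : ∀ {f x} → f < k → k ≤ x →
                     dist (node k l r) f x ≡ depth (node k l r) f ℕ.+ depth (node k l r) x
  dist-left-across {f} {x} f<k k≤x
    rewrite dec-true (f ℕ.<? k) f<k | dec-false (x ℕ.<? k) (ℕ.≤⇒≯ k≤x) | dec-false (k ℕ.<? f) (ℕ.<⇒≯ f<k) = refl

  dist-right-across : ∀ {f x} → k < f → x ≤ k →
                      dist (node k l r) f x ≡ depth (node k l r) f ℕ.+ depth (node k l r) x
  dist-right-across {f} {x} k<f x≤k
    rewrite dec-false (f ℕ.<? k) (ℕ.<⇒≯ k<f) | dec-true (k ℕ.<? f) k<f | dec-false (k ℕ.<? x) (ℕ.≤⇒≯ x≤k) = refl

threshold-crossing : ∀ (P : ℕ → ℚ) t k → P 0 ℚ.≤ t → t ℚ.≤ P (suc k) →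
                     ∃[ j ] j ≤ k × P j ℚ.≤ t × t ℚ.≤ P (suc j)
threshold-crossing P t zero    P0≤t t≤P1 = 0 , z≤n , P0≤t , t≤P1
threshold-crossing P t (suc k) P0≤t t≤P with P (suc k) ℚ.≤? t
... | yes P≤t = suc k , ℕ.≤-refl , P≤t , t≤P
... | no  P≰t with threshold-crossing P t k P0≤t (ℚ.<⇒≤ (ℚ.≰⇒> P≰t))
...   | j , j≤k , crossing = j , ℕ.m≤n⇒m≤1+n j≤k , crossing

2*-+ : ∀ p → 2ℚ * p ≡ p + p
2*-+ p = solve 1 (λ p → con 2ℚ :* p := p :+ p) refl p

module _ (g : ℕ → ℚ) (0≤g : ∀ i → 0ℚ ℚ.≤ g i) where

  Balanced : ∀ {lo hi} → BST lo hi → Set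
  Balanced {lo} {hi} T = ∀ x → lo ≤ x → x < hi → powℚ 2ℚ (depth T x) * g x ℚ.≤ sumRange g lo hi

  -- The root is the last key whose strict prefix carries at most half of the total weight.
  balancedRoot : ∀ lo hi → lo < hi →
                 ∃[ k ] lo ≤ k × k < hi × 2ℚ * sumRange g lo k ℚ.≤ sumRange g lo hi
                                        × 2ℚ * sumRange g (suc k) hi ℚ.≤ sumRange g lo hi
  balancedRoot lo hi lo<hi = k , lo≤k , k<hi , 2L≤V , 2R≤V
    where
    V = sumRange g lo hi
    len≡ : hi ℕ.∸ lo ≡ suc (hi ℕ.∸ suc lo)
    len≡ = ℕ.+-∸-assoc 1 lo<hi
    crossing = threshold-crossing (λ j → 2ℚ * sumFrom g lo j) V (hi ℕ.∸ suc lo)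
                 (ℚ.≤-trans (ℚ.≤-reflexive (ℚ.*-zeroʳ 2ℚ)) (sumRange-nonNeg g 0≤g lo hi))
                 (subst (λ j → V ℚ.≤ 2ℚ * sumFrom g lo j) len≡
                   (ℚ.≤-trans (p≤p+q (sumRange-nonNeg g 0≤g lo hi)) (ℚ.≤-reflexive (sym (2*-+ V)))))
    j = proj₁ crossing
    j≤ = proj₁ (proj₂ crossing)
    k = lo ℕ.+ j
    lo≤k = ℕ.m≤m+n lo j
    k<hi : k < hi
    k<hi = subst (_≤ hi) (ℕ.+-suc lo j) (ℕ.≤-trans (ℕ.+-monoʳ-≤ lo (s≤s j≤))
             (ℕ.≤-reflexive (trans (cong (lo ℕ.+_) (sym len≡)) (ℕ.m+[n∸m]≡n (ℕ.<⇒≤ lo<hi)))))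
    L = sumFrom g lo j
    R = sumRange g (suc k) hi
    L≡ : sumRange g lo k ≡ L
    L≡ = cong (sumFrom g lo) (ℕ.m+n∸m≡n lo j)
    V≡ : V ≡ L + (g k + R)
    V≡ = trans (sumRange-pick g lo k hi lo≤k k<hi) (cong (_+ (g k + R)) L≡)
    V≤2[L+gk] : V ℚ.≤ 2ℚ * (L + g k)
    V≤2[L+gk] = subst (λ x → V ℚ.≤ 2ℚ * x) (sumFrom-snoc g lo j) (proj₂ (proj₂ (proj₂ crossing)))
    2L≤V : 2ℚ * sumRange g lo k ℚ.≤ V
    2L≤V = subst (λ x → 2ℚ * x ℚ.≤ V) (sym L≡) (proj₁ (proj₂ (proj₂ crossing)))
    2R≤V : 2ℚ * R ℚ.≤ V
    2R≤V = begin
      2ℚ * R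
        ≡⟨ solve 3 (λ L x R → con 2ℚ :* R := con 2ℚ :* (L :+ (x :+ R)) :- con 2ℚ :* (L :+ x)) refl L (g k) R ⟩
      2ℚ * (L + (g k + R)) - 2ℚ * (L + g k)   ≡⟨ cong (λ v → 2ℚ * v - 2ℚ * (L + g k)) (sym V≡) ⟩
      2ℚ * V - 2ℚ * (L + g k)                 ≤⟨ ℚ.+-monoʳ-≤ (2ℚ * V) (ℚ.neg-antimono-≤ V≤2[L+gk]) ⟩
      2ℚ * V - V                              ≡⟨ solve 1 (λ V → con 2ℚ :* V :- V := V) refl V ⟩
      V                                       ∎
      where open ℚ.≤-Reasoning

  private
    doubling : ∀ d x {S V} → powℚ 2ℚ d * g x ℚ.≤ S → 2ℚ * S ℚ.≤ V → powℚ 2ℚ (suc d) * g x ℚ.≤ V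
    doubling d x {S} {V} 2ᵈg≤S 2S≤V = begin
      2ℚ * powℚ 2ℚ d * g x    ≡⟨ ℚ.*-assoc 2ℚ (powℚ 2ℚ d) (g x) ⟩
      2ℚ * (powℚ 2ℚ d * g x)  ≤⟨ *-monoˡ-≤-0≤ 0≤2ℚ 2ᵈg≤S ⟩
      2ℚ * S                  ≤⟨ 2S≤V ⟩
      V                       ∎
      where open ℚ.≤-Reasoning

  node-balanced : ∀ {lo hi} k (tₗ : BST lo k) (tᵣ : BST (suc k) hi) → lo ≤ k → k < hi →
                  2ℚ * sumRange g lo k ℚ.≤ sumRange g lo hi → 2ℚ * sumRange g (suc k) hi ℚ.≤ sumRange g lo hi →
                  Balanced tₗ → Balanced tᵣ → Balanced (node k tₗ tᵣ)
  node-balanced {lo} {hi} k tₗ tᵣ lo≤k k<hi 2L≤V 2R≤V tₗ-balanced tᵣ-balanced x lo≤x x<hi with ℕ.<-cmp x k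
  ... | tri< x<k _ _ = subst (λ d → powℚ 2ℚ d * g x ℚ.≤ sumRange g lo hi) (sym (depth-left k tₗ tᵣ x<k))
                         (doubling (depth tₗ x) x (tₗ-balanced x lo≤x x<k) 2L≤V)
  ... | tri> _ _ k<x = subst (λ d → powℚ 2ℚ d * g x ℚ.≤ sumRange g lo hi) (sym (depth-right k tₗ tᵣ k<x))
                         (doubling (depth tᵣ x) x (tᵣ-balanced x k<x x<hi) 2R≤V)
  ... | tri≈ _ refl _ = begin
    powℚ 2ℚ (depth (node k tₗ tᵣ) k) * g k  ≡⟨ cong (λ d → powℚ 2ℚ d * g k) (depth-root k tₗ tᵣ) ⟩
    1ℚ * g k                                ≡⟨ ℚ.*-identityˡ (g k) ⟩
    g k                                     ≤⟨ term≤sumRange g 0≤g lo k hi lo≤k k<hi ⟩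
    sumRange g lo hi                        ∎
    where open ℚ.≤-Reasoning

  weightBalanced : ∀ lo hi → lo ≤ hi → Σ (BST lo hi) Balanced
  weightBalanced lo hi = build (hi ℕ.∸ lo) lo hi ℕ.≤-refl
    where
    build : ∀ size lo hi → hi ℕ.∸ lo ≤ size → lo ≤ hi → Σ (BST lo hi) Balanced
    build size lo hi _ lo≤hi with ℕ.m≤n⇒m<n∨m≡n lo≤hi
    ... | inj₂ refl = empty , λ x lo≤x x<lo → ⊥-elim (ℕ.<⇒≱ x<lo lo≤x)
    build zero lo hi size≤ _ | inj₁ lo<hi = ⊥-elim (ℕ.<⇒≱ (ℕ.<-≤-trans (ℕ.m<n⇒0<n∸m lo<hi) size≤) z≤n)
    build (suc size) lo hi size≤ _ | inj₁ lo<hi =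
      let k , lo≤k , k<hi , 2L≤V , 2R≤V = balancedRoot lo hi lo<hi
          tₗ , tₗ-balanced = build size lo k (ℕ.≤-pred (ℕ.<-≤-trans (ℕ.∸-monoˡ-< k<hi lo≤k) size≤)) lo≤k
          tᵣ , tᵣ-balanced = build size (suc k) hi (ℕ.≤-pred (ℕ.<-≤-trans (ℕ.∸-monoʳ-< (s≤s lo≤k) k<hi) size≤)) k<hi
      in node k tₗ tᵣ , node-balanced k tₗ tᵣ lo≤k k<hi 2L≤V 2R≤V tₗ-balanced tᵣ-balanced

kraftSum : ∀ {lo hi} → BST lo hi → ℚ
kraftSum {lo} {hi} T = sumRange (λ x → powℚ ¼ (depth T x)) lo hi

fingerSum : ∀ {lo hi} → BST lo hi → ℕ → ℚ
fingerSum {lo} {hi} T f = sumRange (λ x → powℚ ¼ (dist T f x)) lo hi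

kraftSum-subtree : ∀ {a b} (c : BST a b) (d : ℕ → ℕ) e → (∀ x → a ≤ x → x < b → d x ≡ e ℕ.+ suc (depth c x)) →
                   sumRange (λ x → powℚ ¼ (d x)) a b ≡ powℚ ¼ e * (¼ * kraftSum c)
kraftSum-subtree {a} {b} c d e d≡ = begin
  sumRange (λ x → powℚ ¼ (d x)) a b                            ≡⟨ sumRange-cong a b (lo≤hi c) (λ x a≤x x<b →
                                                                    trans (cong (powℚ ¼) (d≡ x a≤x x<b)) (pow-+ ¼ e (suc (depth c x)))) ⟩
  sumRange (λ x → powℚ ¼ e * (¼ * powℚ ¼ (depth c x))) a b     ≡⟨ sym (*-distribˡ-sumFrom (powℚ ¼ e) _ a (b ℕ.∸ a)) ⟩
  powℚ ¼ e * sumRange (λ x → ¼ * powℚ ¼ (depth c x)) a b       ≡⟨ cong (powℚ ¼ e *_) (sym (*-distribˡ-sumFrom ¼ _ a (b ℕ.∸ a))) ⟩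
  powℚ ¼ e * (¼ * kraftSum c)                                  ∎
  where open ≡-Reasoning

module _ {lo hi : ℕ} (k : ℕ) (l : BST lo k) (r : BST (suc k) hi) where

  private
    sumRange-node : ∀ h → sumRange h lo hi ≡ sumRange h lo k + (h k + sumRange h (suc k) hi)
    sumRange-node h = sumRange-pick h lo k hi (lo≤hi l) (lo≤hi r)

    ¼^depth : ℕ → ℚ
    ¼^depth x = powℚ ¼ (depth (node k l r) x)

    ¼^dist : ℕ → ℕ → ℚ
    ¼^dist f x = powℚ ¼ (dist (node k l r) f x)

  kraftSum-node : kraftSum (node k l r) ≡ ¼ * kraftSum l + (1ℚ + ¼ * kraftSum r)
  kraftSum-node = begin
    kraftSum (node k l r)                                                 ≡⟨ sumRange-node ¼^depth ⟩
    sumRange ¼^depth lo k + (¼^depth k + sumRange ¼^depth (suc k) hi)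
      ≡⟨ cong₂ (λ L R → L + (¼^depth k + R)) (kraftSum-subtree l _ 0 (λ x _ x<k → depth-left k l r x<k))
                                             (kraftSum-subtree r _ 0 (λ x k<x _ → depth-right k l r k<x)) ⟩
    1ℚ * (¼ * kraftSum l) + (¼^depth k + 1ℚ * (¼ * kraftSum r))
      ≡⟨ cong₂ (λ L R → L + (¼^depth k + R)) (ℚ.*-identityˡ (¼ * kraftSum l)) (ℚ.*-identityˡ (¼ * kraftSum r)) ⟩
    ¼ * kraftSum l + (¼^depth k + ¼ * kraftSum r)
      ≡⟨ cong (λ d → ¼ * kraftSum l + (powℚ ¼ d + ¼ * kraftSum r)) (depth-root k l r) ⟩
    ¼ * kraftSum l + (1ℚ + ¼ * kraftSum r)                               ∎
    where open ≡-Reasoning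

  fingerSum-root : fingerSum (node k l r) k ≡ kraftSum (node k l r)
  fingerSum-root = sumRange-cong lo hi (lo≤hi (node k l r)) (λ x _ _ → cong (powℚ ¼) (dist-root k l r x))

  fingerSum-left : ∀ {f} → f < k → let E = powℚ ¼ (suc (depth l f)) in
                   fingerSum (node k l r) f ≡ fingerSum l f + (E + E * (¼ * kraftSum r))
  fingerSum-left {f} f<k = begin
    fingerSum (node k l r) f                                                  ≡⟨ sumRange-node (¼^dist f) ⟩
    sumRange (¼^dist f) lo k + (¼^dist f k + sumRange (¼^dist f) (suc k) hi)
      ≡⟨ cong₂ _+_ (sumRange-cong lo k (lo≤hi l) λ x _ x<k → cong (powℚ ¼) (dist-left k l r f<k x<k))
                   (cong₂ _+_ (cong (powℚ ¼) at-root) (kraftSum-subtree r _ (suc e) at-right)) ⟩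
    fingerSum l f + (powℚ ¼ (suc e) + powℚ ¼ (suc e) * (¼ * kraftSum r))     ∎
    where
    open ≡-Reasoning
    e = depth l f
    at-root : dist (node k l r) f k ≡ suc e
    at-root = trans (dist-left-across k l r f<k ℕ.≤-refl)
                    (trans (cong₂ ℕ._+_ (depth-left k l r f<k) (depth-root k l r)) (ℕ.+-identityʳ (suc e)))
    at-right : ∀ x → suc k ≤ x → x < hi → dist (node k l r) f x ≡ suc e ℕ.+ suc (depth r x)
    at-right x k<x _ = trans (dist-left-across k l r f<k (ℕ.<⇒≤ k<x))
                             (cong₂ ℕ._+_ (depth-left k l r f<k) (depth-right k l r k<x))

  fingerSum-right : ∀ {f} → k < f → let E = powℚ ¼ (suc (depth r f)) in
                    fingerSum (node k l r) f ≡ E * (¼ * kraftSum l) + (E + fingerSum r f)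
  fingerSum-right {f} k<f = begin
    fingerSum (node k l r) f                                                  ≡⟨ sumRange-node (¼^dist f) ⟩
    sumRange (¼^dist f) lo k + (¼^dist f k + sumRange (¼^dist f) (suc k) hi)
      ≡⟨ cong₂ _+_ (kraftSum-subtree l _ (suc e) at-left)
                   (cong₂ _+_ (cong (powℚ ¼) at-root)
                              (sumRange-cong (suc k) hi (lo≤hi r) λ x k<x _ → cong (powℚ ¼) (dist-right k l r k<f k<x))) ⟩
    powℚ ¼ (suc e) * (¼ * kraftSum l) + (powℚ ¼ (suc e) + fingerSum r f)     ∎
    where
    open ≡-Reasoning
    e = depth r f
    at-root : dist (node k l r) f k ≡ suc e
    at-root = trans (dist-right-across k l r k<f ℕ.≤-refl)
                    (trans (cong₂ ℕ._+_ (depth-right k l r k<f) (depth-root k l r)) (ℕ.+-identityʳ (suc e)))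
    at-left : ∀ x → lo ≤ x → x < k → dist (node k l r) f x ≡ suc e ℕ.+ suc (depth l x)
    at-left x _ x<k = trans (dist-right-across k l r k<f (ℕ.<⇒≤ x<k))
                            (cong₂ ℕ._+_ (depth-right k l r k<f) (depth-left k l r x<k))

kraft : ∀ {lo hi} (T : BST lo hi) → kraftSum T ℚ.≤ 2ℚ
kraft {lo} empty = ℚ.≤-trans (ℚ.≤-reflexive (sumRange-empty _ lo)) 0≤2ℚ
kraft (node k l r) = begin
  kraftSum (node k l r)                    ≡⟨ kraftSum-node k l r ⟩
  ¼ * kraftSum l + (1ℚ + ¼ * kraftSum r)   ≤⟨ ℚ.+-mono-≤ (*-monoˡ-≤-0≤ 0≤¼ (kraft l)) (ℚ.+-monoʳ-≤ 1ℚ (*-monoˡ-≤-0≤ 0≤¼ (kraft r))) ⟩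
  ¼ * 2ℚ + (1ℚ + ¼ * 2ℚ)                   ≡⟨⟩
  2ℚ                                       ∎
  where open ℚ.≤-Reasoning

-- The extra term ½·4^-depth(f) makes the induction work: passing from a subtree to its parent, it
-- pays for the parent, the sibling subtree and the parent's own, smaller, extra term.
fingerKraft : ∀ {lo hi} (T : BST lo hi) f → lo ≤ f → f < hi →
              fingerSum T f + ½ * powℚ ¼ (depth T f) ℚ.≤ ℤ.+ 5 ℚ./ 2
fingerKraft empty f lo≤f f<lo = ⊥-elim (ℕ.<⇒≱ f<lo lo≤f)
fingerKraft (node k l r) f lo≤f f<hi with ℕ.<-cmp f k
... | tri≈ _ refl _ = begin
  fingerSum (node k l r) k + ½ * powℚ ¼ (depth (node k l r) k)
    ≡⟨ cong₂ (λ S d → S + ½ * powℚ ¼ d) (fingerSum-root k l r) (depth-root k l r) ⟩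
  kraftSum (node k l r) + ½ * 1ℚ
    ≤⟨ ℚ.+-monoˡ-≤ (½ * 1ℚ) (kraft (node k l r)) ⟩
  2ℚ + ½ * 1ℚ
    ≡⟨⟩
  ℤ.+ 5 ℚ./ 2
    ∎
  where open ℚ.≤-Reasoning
... | tri< f<k _ _ = begin
  fingerSum (node k l r) f + ½ * powℚ ¼ (depth (node k l r) f)
    ≡⟨ cong₂ (λ S d → S + ½ * powℚ ¼ d) (fingerSum-left k l r f<k) (depth-left k l r f<k) ⟩
  fingerSum l f + (E + E * (¼ * kraftSum r)) + ½ * E
    ≤⟨ ℚ.+-monoˡ-≤ (½ * E) (ℚ.+-monoʳ-≤ (fingerSum l f) (ℚ.+-monoʳ-≤ E (*-monoˡ-≤-0≤ 0≤E (*-monoˡ-≤-0≤ 0≤¼ (kraft r))))) ⟩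
  fingerSum l f + (E + E * (¼ * 2ℚ)) + ½ * E
    ≡⟨ solve 2 (λ S e → S :+ (con ¼ :* e :+ con ¼ :* e :* (con ¼ :* con 2ℚ)) :+ con ½ :* (con ¼ :* e) := S :+ con ½ :* e)
               refl (fingerSum l f) (powℚ ¼ (depth l f)) ⟩
  fingerSum l f + ½ * powℚ ¼ (depth l f)
    ≤⟨ fingerKraft l f lo≤f f<k ⟩
  ℤ.+ 5 ℚ./ 2
    ∎
  where
  open ℚ.≤-Reasoning
  E = powℚ ¼ (suc (depth l f))
  0≤E = pow-nonNeg (suc (depth l f)) 0≤¼
... | tri> _ _ k<f = begin
  fingerSum (node k l r) f + ½ * powℚ ¼ (depth (node k l r) f)
    ≡⟨ cong₂ (λ S d → S + ½ * powℚ ¼ d) (fingerSum-right k l r k<f) (depth-right k l r k<f) ⟩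
  E * (¼ * kraftSum l) + (E + fingerSum r f) + ½ * E
    ≤⟨ ℚ.+-monoˡ-≤ (½ * E) (ℚ.+-monoˡ-≤ (E + fingerSum r f) (*-monoˡ-≤-0≤ 0≤E (*-monoˡ-≤-0≤ 0≤¼ (kraft l)))) ⟩
  E * (¼ * 2ℚ) + (E + fingerSum r f) + ½ * E
    ≡⟨ solve 2 (λ S e → con ¼ :* e :* (con ¼ :* con 2ℚ) :+ (con ¼ :* e :+ S) :+ con ½ :* (con ¼ :* e) := S :+ con ½ :* e)
               refl (fingerSum r f) (powℚ ¼ (depth r f)) ⟩
  fingerSum r f + ½ * powℚ ¼ (depth r f)
    ≤⟨ fingerKraft r f k<f f<hi ⟩
  ℤ.+ 5 ℚ./ 2
    ∎
  where
  open ℚ.≤-Reasoning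
  E = powℚ ¼ (suc (depth r f))
  0≤E = pow-nonNeg (suc (depth r f)) 0≤¼

telescope-step : ∀ {a b} → 0ℚ ℚ.< a → 0ℚ ℚ.≤ b → b * inv₀ (a + b) ² ℚ.≤ inv₀ a - inv₀ (a + b)
telescope-step {a} {b} 0<a 0≤b = begin
  b * (ic * ic)                    ≤⟨ *-monoˡ-≤-0≤ 0≤b (*-monoʳ-≤-0≤ (inv₀-nonNeg (a + b)) (inv₀-antimono 0<a (p≤p+q 0≤b))) ⟩
  b * (ia * ic)                    ≡⟨ solve 4 (λ a b ia ic → b :* (ia :* ic) := ((a :+ b) :* ic) :* ia :- (a :* ia) :* ic) refl a b ia ic ⟩
  (a + b) * ic * ia - a * ia * ic  ≡⟨ cong₂ (λ x y → x * ia - y * ic) (*-inv₀ (+-pos 0<a 0≤b)) (*-inv₀ 0<a) ⟩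
  1ℚ * ia - 1ℚ * ic                ≡⟨ cong₂ _-_ (ℚ.*-identityˡ ia) (ℚ.*-identityˡ ic) ⟩
  ia - ic                          ∎
  where
  open ℚ.≤-Reasoning
  ia = inv₀ a
  ic = inv₀ (a + b)

telescope : ∀ (A b : ℕ → ℚ) T → (∀ t → 0ℚ ℚ.< A t) → (∀ t → 0ℚ ℚ.≤ b t) →
            (∀ t → t < T → A (suc t) ≡ A t + b t) →
            sumFrom (λ t → b t * inv₀ (A (suc t)) ²) 0 T ℚ.≤ inv₀ (A 0) - inv₀ (A T)
telescope A b zero    0<A 0≤b A-step = ℚ.≤-reflexive (sym (ℚ.+-inverseʳ (inv₀ (A 0))))
telescope A b (suc T) 0<A 0≤b A-step = begin
  sumFrom term 0 (suc T)                                    ≡⟨ sumFrom-snoc term 0 T ⟩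
  sumFrom term 0 T + b T * inv₀ (A (suc T)) ²
    ≤⟨ ℚ.+-monoˡ-≤ (b T * inv₀ (A (suc T)) ²) (telescope A b T 0<A 0≤b (λ t t<T → A-step t (ℕ.m<n⇒m<1+n t<T))) ⟩
  inv₀ (A 0) - inv₀ (A T) + b T * inv₀ (A (suc T)) ²        ≡⟨ cong (λ x → inv₀ (A 0) - inv₀ (A T) + b T * inv₀ x ²) A[1+T]≡ ⟩
  inv₀ (A 0) - inv₀ (A T) + b T * inv₀ (A T + b T) ²        ≤⟨ ℚ.+-monoʳ-≤ (inv₀ (A 0) - inv₀ (A T)) (telescope-step (0<A T) (0≤b T)) ⟩
  inv₀ (A 0) - inv₀ (A T) + (inv₀ (A T) - inv₀ (A T + b T))
    ≡⟨ solve 3 (λ x y z → x :- y :+ (y :- z) := x :- z) refl (inv₀ (A 0)) (inv₀ (A T)) (inv₀ (A T + b T)) ⟩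
  inv₀ (A 0) - inv₀ (A T + b T)                             ≡⟨ cong (λ x → inv₀ (A 0) - inv₀ x) (sym A[1+T]≡) ⟩
  inv₀ (A 0) - inv₀ (A (suc T))                             ∎
  where
  open ℚ.≤-Reasoning
  term = λ t → b t * inv₀ (A (suc t)) ²
  A[1+T]≡ = A-step T ℕ.≤-refl

telescope-bound : ∀ (A b : ℕ → ℚ) T → (∀ t → 0ℚ ℚ.< A t) → (∀ t → 0ℚ ℚ.≤ b t) →
                  (∀ t → t < T → A (suc t) ≡ A t + b t) →
                  sumFrom (λ t → b t * inv₀ (A (suc t)) ²) 0 T ℚ.≤ inv₀ (A 0)
telescope-bound A b T 0<A 0≤b A-step = begin
  sumFrom (λ t → b t * inv₀ (A (suc t)) ²) 0 T  ≤⟨ telescope A b T 0<A 0≤b A-step ⟩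
  inv₀ (A 0) - inv₀ (A T)                       ≤⟨ ℚ.+-monoʳ-≤ (inv₀ (A 0)) (ℚ.neg-antimono-≤ (inv₀-nonNeg (A T))) ⟩
  inv₀ (A 0) - 0ℚ                               ≡⟨ ℚ.+-identityʳ _ ⟩
  inv₀ (A 0)                                    ∎
  where open ℚ.≤-Reasoning

module Relative (g : ℕ → ℚ) (0≤g : ∀ i → 0ℚ ℚ.≤ g i) (f : ℕ) (0<gf : 0ℚ ℚ.< g f) where

  -- g x / (Σ of g between f and x)², which telescopes on either side of f.
  relative : ℕ → ℚ
  relative x = g x * inv₀ (sumRange g (f ⊓ x) (suc (f ⊔ x))) ²

  relative-finger : relative f ≡ inv₀ (g f)
  relative-finger = begin
    g f * inv₀ (sumRange g (f ⊓ f) (suc (f ⊔ f))) ²  ≡⟨ cong₂ (λ a b → g f * inv₀ (sumRange g a (suc b)) ²) (ℕ.⊓-idem f) (ℕ.⊔-idem f) ⟩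
    g f * inv₀ (sumRange g f (suc f)) ²              ≡⟨ cong (λ s → g f * inv₀ s ²) (sumRange-singleton g f) ⟩
    g f * (inv₀ (g f) * inv₀ (g f))                  ≡⟨ sym (ℚ.*-assoc (g f) _ _) ⟩
    g f * inv₀ (g f) * inv₀ (g f)                    ≡⟨ cong (_* inv₀ (g f)) (*-inv₀ 0<gf) ⟩
    1ℚ * inv₀ (g f)                                  ≡⟨ ℚ.*-identityˡ _ ⟩
    inv₀ (g f)                                       ∎
    where open ≡-Reasoning

  relative-right : ∀ T → sumFrom relative (suc f) T ℚ.≤ inv₀ (g f)
  relative-right T = begin
    sumFrom relative (suc f) T                    ≡⟨ sumFrom-shift relative (suc f) T ⟩
    sumFrom (λ t → relative (suc f ℕ.+ t)) 0 T    ≡⟨ sumFrom-cong 0 T (λ t _ _ → cong (λ s → b t * inv₀ s ²) (interval≡ t)) ⟩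
    sumFrom (λ t → b t * inv₀ (A (suc t)) ²) 0 T  ≤⟨ telescope-bound A b T 0<A (λ t → 0≤g _) (λ t _ → A-step t) ⟩
    inv₀ (g f + 0ℚ)                               ≡⟨ cong inv₀ (ℚ.+-identityʳ (g f)) ⟩
    inv₀ (g f)                                    ∎
    where
    open ℚ.≤-Reasoning
    A = λ t → sumFrom g f (suc t)
    b = λ t → g (suc (f ℕ.+ t))
    0<A : ∀ t → 0ℚ ℚ.< A t
    0<A t = +-pos 0<gf (sumFrom-nonNeg g 0≤g (suc f) t)
    A-step : ∀ t → A (suc t) ≡ A t + b t
    A-step t = trans (sumFrom-snoc g f (suc t)) (cong (λ i → A t + g i) (ℕ.+-suc f t))
    interval≡ : ∀ t → sumRange g (f ⊓ suc (f ℕ.+ t)) (suc (f ⊔ suc (f ℕ.+ t))) ≡ A (suc t)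
    interval≡ t = trans (cong₂ (λ a b → sumRange g a (suc b)) (ℕ.m≤n⇒m⊓n≡m f≤) (ℕ.m≤n⇒m⊔n≡n f≤))
                        (cong (sumFrom g f) (trans (ℕ.+-∸-assoc 2 (ℕ.m≤m+n f t)) (cong (2 ℕ.+_) (ℕ.m+n∸m≡n f t))))
      where f≤ = ℕ.m≤n⇒m≤1+n (ℕ.m≤m+n f t)

  relative-left : sumFrom relative 0 f ℚ.≤ inv₀ (g f)
  relative-left = begin
    sumFrom relative 0 f                          ≡⟨ sumFrom-reverse relative f ⟩
    sumFrom (λ t → relative (f ℕ.∸ suc t)) 0 f    ≡⟨ sumFrom-cong 0 f (λ t _ _ → cong (λ s → b t * inv₀ s ²) (interval≡ t)) ⟩
    sumFrom (λ t → b t * inv₀ (A (suc t)) ²) 0 f  ≤⟨ telescope-bound A b f 0<A (λ t → 0≤g _) A-step ⟩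
    inv₀ (A 0)                                    ≡⟨ cong inv₀ (sumRange-singleton g f) ⟩
    inv₀ (g f)                                    ∎
    where
    open ℚ.≤-Reasoning
    A = λ t → sumRange g (f ℕ.∸ t) (suc f)
    b = λ t → g (f ℕ.∸ suc t)
    0<A : ∀ t → 0ℚ ℚ.< A t
    0<A t = ℚ.<-≤-trans 0<gf (term≤sumRange g 0≤g (f ℕ.∸ t) f (suc f) (ℕ.m∸n≤m f t) ℕ.≤-refl)
    A-step : ∀ t → t < f → A (suc t) ≡ A t + b t
    A-step t t<f = trans (sumRange-uncons g (f ℕ.∸ suc t) (suc f) (s≤s (ℕ.m∸n≤m f (suc t))))
                         (trans (cong (λ i → b t + sumRange g i (suc f)) (sym (ℕ.+-∸-assoc 1 t<f))) (ℚ.+-comm (b t) (A t)))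
    interval≡ : ∀ t → sumRange g (f ⊓ (f ℕ.∸ suc t)) (suc (f ⊔ (f ℕ.∸ suc t))) ≡ A (suc t)
    interval≡ t = cong₂ (λ a b → sumRange g a (suc b)) (ℕ.m≥n⇒m⊓n≡n (ℕ.m∸n≤m f (suc t))) (ℕ.m≥n⇒m⊔n≡m (ℕ.m∸n≤m f (suc t)))

  relative-total : ∀ n → f < n → sumFrom relative 0 n ℚ.≤ inv₀ (g f) + (inv₀ (g f) + inv₀ (g f))
  relative-total n f<n = begin
    sumRange relative 0 n                                             ≡⟨ sumRange-pick relative 0 f n z≤n f<n ⟩
    sumFrom relative 0 f + (relative f + sumRange relative (suc f) n)
      ≤⟨ ℚ.+-mono-≤ relative-left (ℚ.+-mono-≤ (ℚ.≤-reflexive relative-finger) (relative-right (n ℕ.∸ suc f))) ⟩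
    inv₀ (g f) + (inv₀ (g f) + inv₀ (g f))                            ∎
    where open ℚ.≤-Reasoning

-- With cost = log (num / den): cost F ≤ c · cost G + e · m, witnessed for every witness of G
-- (no slack δ, unlike _≤[_,_]_).
record _≼[_,_]⟨_⟩_ (F : Bound) (c e m : ℕ) (G : Bound) : Set where
  field
    dominate : ∀ g → ∃[ f ] (num F f * powℚ (den G g) c ℚ.≤ powℚ 2ℚ (e ℕ.* m) * powℚ (num G g) c * den F f)
open _≼[_,_]⟨_⟩_

PositiveBound : Bound → Set
PositiveBound B = ∀ x → 0ℚ ℚ.< num B x × 0ℚ ℚ.< den B x

≼-refl : ∀ {m} F → F ≼[ 1 , 0 ]⟨ m ⟩ F
≼-refl F .dominate x = x , ℚ.≤-reflexive (solve 2 (λ a b → a :* (b :* con 1ℚ) := con 1ℚ :* (a :* con 1ℚ) :* b) refl (num F x) (den F x))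

≼-trans : ∀ {m c₁ e₁ c₂ e₂} {F G H : Bound} → PositiveBound F → PositiveBound G → PositiveBound H →
          F ≼[ c₁ , e₁ ]⟨ m ⟩ G → G ≼[ c₂ , e₂ ]⟨ m ⟩ H → F ≼[ c₂ ℕ.* c₁ , e₁ ℕ.+ c₁ ℕ.* e₂ ]⟨ m ⟩ H
≼-trans {m} {c₁} {e₁} {c₂} {e₂} {F} {G} {H} F>0 G>0 H>0 F≼G G≼H .dominate h = f , cancel (begin
  dg^c₁ * (nf * powℚ dh c)                       ≡⟨ solve 3 (λ x y z → x :* (y :* z) := y :* x :* z) refl dg^c₁ nf (powℚ dh c) ⟩
  nf * dg^c₁ * powℚ dh c                         ≤⟨ *-monoʳ-≤-0≤ (pow-nonNeg c (0≤den H h H>0)) F≤G ⟩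
  K₁ * powℚ ng c₁ * df * powℚ dh c
    ≡⟨ solve 4 (λ k x d y → k :* x :* d :* y := k :* d :* (x :* y)) refl K₁ (powℚ ng c₁) df (powℚ dh c) ⟩
  K₁ * df * (powℚ ng c₁ * powℚ dh c)             ≤⟨ *-monoˡ-≤-0≤ (*-nonNeg (pow-nonNeg (e₁ ℕ.* m) 0≤2ℚ) (0≤den F f F>0)) G≤H^c₁ ⟩
  K₁ * df * (powℚ K₂ c₁ * powℚ nh c * dg^c₁)
    ≡⟨ solve 5 (λ k d k′ x y → k :* d :* (k′ :* x :* y) := y :* (k :* k′ :* x :* d)) refl K₁ df (powℚ K₂ c₁) (powℚ nh c) dg^c₁ ⟩
  dg^c₁ * (K₁ * powℚ K₂ c₁ * powℚ nh c * df)     ≡⟨ cong (λ K → dg^c₁ * (K * powℚ nh c * df)) K₁K₂^c₁≡ ⟩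
  dg^c₁ * (powℚ 2ℚ ((e₁ ℕ.+ c₁ ℕ.* e₂) ℕ.* m) * powℚ nh c * df) ∎)
  where
  open ℚ.≤-Reasoning
  g = proj₁ (dominate G≼H h)
  f = proj₁ (dominate F≼G g)
  F≤G = proj₂ (dominate F≼G g)
  G≤H = proj₂ (dominate G≼H h)
  nf = num F f ; df = den F f ; ng = num G g ; dg = den G g ; nh = num H h ; dh = den H h
  c = c₂ ℕ.* c₁
  K₁ = powℚ 2ℚ (e₁ ℕ.* m)
  K₂ = powℚ 2ℚ (e₂ ℕ.* m)
  dg^c₁ = powℚ dg c₁
  0≤den : ∀ B x → PositiveBound B → 0ℚ ℚ.≤ den B x
  0≤den B x B>0 = ℚ.<⇒≤ (proj₂ (B>0 x))
  cancel = ℚ.*-cancelˡ-≤-pos dg^c₁ {{ℚ.positive (pow-pos c₁ (proj₂ (G>0 g)))}}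
  G≤H^c₁ : powℚ ng c₁ * powℚ dh c ℚ.≤ powℚ K₂ c₁ * powℚ nh c * dg^c₁
  G≤H^c₁ = begin
    powℚ ng c₁ * powℚ dh c                     ≡⟨ cong (powℚ ng c₁ *_) (pow-* dh c₂ c₁) ⟩
    powℚ ng c₁ * powℚ (powℚ dh c₂) c₁          ≤⟨ pow-mono-≤-* c₁ (ℚ.<⇒≤ (proj₁ (G>0 g))) (pow-nonNeg c₂ (0≤den H h H>0)) G≤H ⟩
    powℚ (K₂ * powℚ nh c₂) c₁ * dg^c₁
      ≡⟨ cong (_* dg^c₁) (trans (pow-distrib-* K₂ (powℚ nh c₂) c₁) (cong (powℚ K₂ c₁ *_) (sym (pow-* nh c₂ c₁)))) ⟩
    powℚ K₂ c₁ * powℚ nh c * dg^c₁             ∎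
  K₁K₂^c₁≡ : K₁ * powℚ K₂ c₁ ≡ powℚ 2ℚ ((e₁ ℕ.+ c₁ ℕ.* e₂) ℕ.* m)
  K₁K₂^c₁≡ = trans (cong (K₁ *_) (sym (pow-* 2ℚ (e₂ ℕ.* m) c₁)))
             (trans (sym (pow-+ 2ℚ (e₁ ℕ.* m) (e₂ ℕ.* m ℕ.* c₁))) (cong (powℚ 2ℚ) exponent≡))
    where
    exponent≡ : e₁ ℕ.* m ℕ.+ e₂ ℕ.* m ℕ.* c₁ ≡ (e₁ ℕ.+ c₁ ℕ.* e₂) ℕ.* m
    exponent≡ = trans (cong (e₁ ℕ.* m ℕ.+_) (trans (ℕ.*-comm (e₂ ℕ.* m) c₁) (sym (ℕ.*-assoc c₁ e₂ m))))
                      (sym (ℕ.*-distribʳ-+ m e₁ (c₁ ℕ.* e₂)))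

≼⇒≤ : ∀ {m c} {F G : Bound} → PositiveBound F → PositiveBound G → F ≼[ c , c ]⟨ m ⟩ G → F ≤[ c , m ] G
≼⇒≤ {m} {c} {F} {G} F>0 G>0 F≼G g δ 1<δ = f , (begin
  num F f * powℚ (den G g) c                 ≤⟨ proj₂ (dominate F≼G g) ⟩
  X                                          ≡⟨ sym (ℚ.*-identityˡ X) ⟩
  1ℚ * X                                     ≤⟨ *-monoʳ-≤-0≤ 0≤X (ℚ.<⇒≤ 1<δ) ⟩
  δ * X
    ≡⟨ solve 4 (λ d k a b → d :* (k :* a :* b) := d :* k :* a :* b) refl δ K (powℚ (num G g) c) (den F f) ⟩
  δ * K * powℚ (num G g) c * den F f         ∎)
  where
  open ℚ.≤-Reasoning
  f = proj₁ (dominate F≼G g)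
  K = powℚ 2ℚ (c ℕ.* m)
  X = K * powℚ (num G g) c * den F f
  0≤X : 0ℚ ℚ.≤ X
  0≤X = *-nonNeg (*-nonNeg (pow-nonNeg (c ℕ.* m) 0≤2ℚ) (pow-nonNeg c (ℚ.<⇒≤ (proj₁ (G>0 g))))) (ℚ.<⇒≤ (proj₂ (F>0 f)))

module Comparisons {n′ m : ℕ} (S : Vec (Fin (suc n′)) m) where

  private
    n = suc n′
    accesses = toList S

  record Factorization (B : Bound) (x : Wit B) : Set where
    field
      numᶠ denᶠ : Fin n → ℚ
      num≡ : num B x ≡ Π numᶠ accesses
      den≡ : den B x ≡ Π denᶠ accesses
      numᶠ-pos : ∀ s → 0ℚ ℚ.< numᶠ s
      denᶠ-pos : ∀ s → 0ℚ ℚ.< denᶠ s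
  open Factorization

  factorization-positive : ∀ {B x} → Factorization B x → 0ℚ ℚ.< num B x × 0ℚ ℚ.< den B x
  factorization-positive φ = subst (0ℚ ℚ.<_) (sym (num≡ φ)) (Π-pos _ (numᶠ-pos φ) accesses)
                           , subst (0ℚ ℚ.<_) (sym (den≡ φ)) (Π-pos _ (denᶠ-pos φ) accesses)

  ≼-factorwise : ∀ c e {F G f g} (φ : Factorization F f) (ψ : Factorization G g) →
                 (∀ s → numᶠ φ s * powℚ (denᶠ ψ s) c ℚ.≤ powℚ 2ℚ e * powℚ (numᶠ ψ s) c * denᶠ φ s) →
                 num F f * powℚ (den G g) c ℚ.≤ powℚ 2ℚ (e ℕ.* m) * powℚ (num G g) c * den F f
  ≼-factorwise c e {F} {G} {f} {g} φ ψ pointwise = begin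
    num F f * powℚ (den G g) c                            ≡⟨ cong₂ (λ a b → a * powℚ b c) (num≡ φ) (den≡ ψ) ⟩
    Π a accesses * powℚ (Π d accesses) c                  ≡⟨ cong (Π a accesses *_) (Π-pow d c accesses) ⟩
    Π a accesses * Π (λ s → powℚ (d s) c) accesses        ≡⟨ sym (Π-* a _ accesses) ⟩
    Π (λ s → a s * powℚ (d s) c) accesses
      ≤⟨ Π-mono-≤ _ _ (λ s → *-nonNeg (ℚ.<⇒≤ (numᶠ-pos φ s)) (pow-nonNeg c (ℚ.<⇒≤ (denᶠ-pos ψ s)))) pointwise accesses ⟩
    Π (λ s → powℚ 2ℚ e * powℚ (b s) c * d′ s) accesses    ≡⟨ Π-* _ d′ accesses ⟩
    Π (λ s → powℚ 2ℚ e * powℚ (b s) c) accesses * Π d′ accesses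
      ≡⟨ cong (_* Π d′ accesses) (Π-* (λ _ → powℚ 2ℚ e) _ accesses) ⟩
    Π (λ _ → powℚ 2ℚ e) accesses * Π (λ s → powℚ (b s) c) accesses * Π d′ accesses
      ≡⟨ cong₂ (λ x y → x * y * Π d′ accesses) 2^em≡ (sym (Π-pow b c accesses)) ⟩
    powℚ 2ℚ (e ℕ.* m) * powℚ (Π b accesses) c * Π d′ accesses
      ≡⟨ cong₂ (λ x y → powℚ 2ℚ (e ℕ.* m) * powℚ x c * y) (sym (num≡ ψ)) (sym (den≡ φ)) ⟩
    powℚ 2ℚ (e ℕ.* m) * powℚ (num G g) c * den F f       ∎
    where
    open ℚ.≤-Reasoning
    a = numᶠ φ ; d′ = denᶠ φ ; b = numᶠ ψ ; d = denᶠ ψ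
    2^em≡ : Π (λ _ → powℚ 2ℚ e) accesses ≡ powℚ 2ℚ (e ℕ.* m)
    2^em≡ = trans (Π-const _ accesses) (trans (cong (powℚ (powℚ 2ℚ e)) (Vec.length-toList S)) (sym (pow-* 2ℚ e m)))

  private
    1≡Π1 : 1ℚ ≡ Π (λ _ → 1ℚ) accesses
    1≡Π1 = sym (trans (Π-const 1ℚ accesses) (pow-1 (length accesses)))

    0<2ℚ : 0ℚ ℚ.< 2ℚ
    0<2ℚ = ℚ.positive⁻¹ 2ℚ

  factorization : ∀ B x → Factorization (bound B S) x
  factorization wb ω = record
    { numᶠ = λ _ → totalW ω ; denᶠ = w ω
    ; num≡ = sym (trans (Π-const (totalW ω) accesses) (cong (powℚ (totalW ω)) (Vec.length-toList S)))
    ; den≡ = refl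
    ; numᶠ-pos = λ _ → totalW-pos ω Fin.zero
    ; denᶠ-pos = pos ω }
  factorization so T = record
    { numᶠ = λ s → powℚ 2ℚ (depth T (toℕ s)) ; denᶠ = λ _ → 1ℚ
    ; num≡ = pow-sumℕ 2ℚ (λ s → depth T (toℕ s)) accesses
    ; den≡ = 1≡Π1
    ; numᶠ-pos = λ s → pow-pos (depth T (toℕ s)) 0<2ℚ
    ; denᶠ-pos = λ _ → ℚ.positive⁻¹ 1ℚ }
  factorization wsf (ω , f) = record
    { numᶠ = intervalW ω f ; denᶠ = λ s → w ω f ℚ.⊓ w ω s
    ; num≡ = refl
    ; den≡ = refl
    ; numᶠ-pos = intervalW-pos ω f
    ; denᶠ-pos = λ s → ⊓-pos (pos ω f) (pos ω s) }
  factorization ff (T , f) = record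
    { numᶠ = λ s → powℚ 2ℚ (dist T (toℕ f) (toℕ s)) ; denᶠ = λ _ → 1ℚ
    ; num≡ = pow-sumℕ 2ℚ (λ s → dist T (toℕ f) (toℕ s)) accesses
    ; den≡ = 1≡Π1
    ; numᶠ-pos = λ s → pow-pos (dist T (toℕ f) (toℕ s)) 0<2ℚ
    ; denᶠ-pos = λ _ → ℚ.positive⁻¹ 1ℚ }

  bound-positive : ∀ B → PositiveBound (bound B S)
  bound-positive B x = factorization-positive (factorization B x)

  SO≼WB : SO S ≼[ 1 , 0 ]⟨ m ⟩ WB S
  SO≼WB .dominate ω = T , ≼-factorwise 1 0 (factorization so T) (factorization wb ω) pointwise
    where
    g = extend (w ω)
    T = proj₁ (weightBalanced g (extend-w-nonNeg ω) 0 n z≤n)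
    T-balanced = proj₂ (weightBalanced g (extend-w-nonNeg ω) 0 n z≤n)
    pointwise : ∀ s → powℚ 2ℚ (depth T (toℕ s)) * powℚ (w ω s) 1 ℚ.≤ powℚ 2ℚ 0 * powℚ (totalW ω) 1 * 1ℚ
    pointwise s = begin
      powℚ 2ℚ (depth T (toℕ s)) * powℚ (w ω s) 1
        ≡⟨ cong (powℚ 2ℚ (depth T (toℕ s)) *_) (trans (ℚ.*-identityʳ (w ω s)) (sym (extend-toℕ (w ω) s))) ⟩
      powℚ 2ℚ (depth T (toℕ s)) * g (toℕ s)        ≤⟨ T-balanced (toℕ s) z≤n (Fin.toℕ<n s) ⟩
      sumFrom g 0 n                                ≡⟨ sym (totalW≡sumFrom ω) ⟩
      totalW ω                                     ≡⟨ solve 1 (λ W → W := con 1ℚ :* (W :* con 1ℚ) :* con 1ℚ) refl (totalW ω) ⟩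
      powℚ 2ℚ 0 * powℚ (totalW ω) 1 * 1ℚ           ∎
      where open ℚ.≤-Reasoning

  FF≼SO : FF S ≼[ 1 , 0 ]⟨ m ⟩ SO S
  FF≼SO .dominate (node k l r) =
    (node k l r , root) , ≼-factorwise 1 0 (factorization ff (node k l r , root)) (factorization so (node k l r)) pointwise
    where
    root = fromℕ< (lo≤hi r)
    pointwise : ∀ s → powℚ 2ℚ (dist (node k l r) (toℕ root) (toℕ s)) * powℚ 1ℚ 1
                      ℚ.≤ powℚ 2ℚ 0 * powℚ (powℚ 2ℚ (depth (node k l r) (toℕ s))) 1 * 1ℚ
    pointwise s = ℚ.≤-reflexive (begin
      powℚ 2ℚ (dist (node k l r) (toℕ root) (toℕ s)) * powℚ 1ℚ 1   ≡⟨ cong (λ d → powℚ 2ℚ d * powℚ 1ℚ 1) dist≡ ⟩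
      powℚ 2ℚ (depth (node k l r) (toℕ s)) * powℚ 1ℚ 1
        ≡⟨ solve 1 (λ x → x :* (con 1ℚ :* con 1ℚ) := con 1ℚ :* (x :* con 1ℚ) :* con 1ℚ) refl (powℚ 2ℚ (depth (node k l r) (toℕ s))) ⟩
      powℚ 2ℚ 0 * powℚ (powℚ 2ℚ (depth (node k l r) (toℕ s))) 1 * 1ℚ ∎)
      where
      open ≡-Reasoning
      dist≡ = trans (cong (λ x → dist (node k l r) x (toℕ s)) (Fin.toℕ-fromℕ< (lo≤hi r))) (dist-root k l r (toℕ s))

  WSF≼WB : WSF S ≼[ 1 , 0 ]⟨ m ⟩ WB S
  WSF≼WB .dominate ω = (ω , f) , ≼-factorwise 1 0 (factorization wsf (ω , f)) (factorization wb ω) pointwise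
    where
    f = argmax (w ω) Fin.zero (allFin n)
    heaviest : ∀ s → w ω s ℚ.≤ w ω f
    heaviest s = All.lookup (f[xs]≤f[argmax] {f = w ω} Fin.zero (allFin n)) (List.∈-allFin s)
    pointwise : ∀ s → intervalW ω f s * powℚ (w ω s) 1 ℚ.≤ powℚ 2ℚ 0 * powℚ (totalW ω) 1 * (w ω f ℚ.⊓ w ω s)
    pointwise s = begin
      intervalW ω f s * powℚ (w ω s) 1                   ≡⟨ cong (intervalW ω f s *_) (ℚ.*-identityʳ (w ω s)) ⟩
      intervalW ω f s * w ω s                            ≤⟨ *-monoʳ-≤-0≤ (ℚ.<⇒≤ (pos ω s)) (intervalW≤totalW ω f s) ⟩
      totalW ω * w ω s                                   ≡⟨ cong₂ _*_ (solve 1 (λ W → W := con 1ℚ :* (W :* con 1ℚ)) refl (totalW ω))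
                                                                      (sym (ℚ.p≥q⇒p⊓q≡q (heaviest s))) ⟩
      powℚ 2ℚ 0 * powℚ (totalW ω) 1 * (w ω f ℚ.⊓ w ω s)  ∎
      where open ℚ.≤-Reasoning

  WB≼-byWeights : ∀ {G g} (ψ : Factorization G g) (ω′ : Weight n) → totalW ω′ ℚ.≤ ℕtoℚ 4 →
                  (∀ s → powℚ (denᶠ ψ s) 2 ℚ.≤ powℚ (numᶠ ψ s) 2 * w ω′ s) →
                  num (WB S) ω′ * powℚ (den G g) 2 ℚ.≤ powℚ 2ℚ (2 ℕ.* m) * powℚ (num G g) 2 * den (WB S) ω′
  WB≼-byWeights ψ ω′ W′≤4 d²≤b²w′ = ≼-factorwise 2 2 (factorization wb ω′) ψ λ s → begin
    totalW ω′ * powℚ (denᶠ ψ s) 2          ≤⟨ *-monoʳ-≤-0≤ (pow-nonNeg 2 (ℚ.<⇒≤ (denᶠ-pos ψ s))) W′≤4 ⟩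
    ℕtoℚ 4 * powℚ (denᶠ ψ s) 2             ≤⟨ *-monoˡ-≤-0≤ (ℚ.<⇒≤ (ℚ.positive⁻¹ (ℕtoℚ 4))) (d²≤b²w′ s) ⟩
    ℕtoℚ 4 * (powℚ (numᶠ ψ s) 2 * w ω′ s)  ≡⟨ sym (ℚ.*-assoc (ℕtoℚ 4) (powℚ (numᶠ ψ s) 2) (w ω′ s)) ⟩
    powℚ 2ℚ 2 * powℚ (numᶠ ψ s) 2 * w ω′ s  ∎
    where open ℚ.≤-Reasoning

  WB≼FF : WB S ≼[ 2 , 2 ]⟨ m ⟩ FF S
  WB≼FF .dominate (T , f) = ω′ , WB≼-byWeights (factorization ff (T , f)) ω′ W′≤4 pointwise
    where
    d : ℕ → ℕ
    d = dist T (toℕ f)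
    ω′ : Weight n
    ω′ = record { w = λ x → powℚ ¼ (d (toℕ x)) ; pos = λ x → pow-pos (d (toℕ x)) (ℚ.positive⁻¹ ¼) }
    W′≤4 : totalW ω′ ℚ.≤ ℕtoℚ 4
    W′≤4 = begin
      totalW ω′                                          ≡⟨ sumℚ-allFin n (λ x → powℚ ¼ (d x)) ⟩
      fingerSum T (toℕ f)                                ≤⟨ p≤p+q (*-nonNeg (ℚ.<⇒≤ (ℚ.positive⁻¹ ½)) (pow-nonNeg (depth T (toℕ f)) 0≤¼)) ⟩
      fingerSum T (toℕ f) + ½ * powℚ ¼ (depth T (toℕ f)) ≤⟨ fingerKraft T (toℕ f) z≤n (Fin.toℕ<n f) ⟩
      ℤ.+ 5 ℚ./ 2                                        ≤⟨ toWitness {a? = ℤ.+ 5 ℚ./ 2 ℚ.≤? ℕtoℚ 4} _ ⟩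
      ℕtoℚ 4                                             ∎
      where open ℚ.≤-Reasoning
    pointwise : ∀ s → powℚ 1ℚ 2 ℚ.≤ powℚ (powℚ 2ℚ (d (toℕ s))) 2 * powℚ ¼ (d (toℕ s))
    pointwise s = ℚ.≤-reflexive (trans (pow-1 2) (sym (pow-2²-¼ (d (toℕ s)))))

  WB≼WSF : WB S ≼[ 2 , 2 ]⟨ m ⟩ WSF S
  WB≼WSF .dominate (ω , f) = ω′ , WB≼-byWeights (factorization wsf (ω , f)) ω′ W′≤4 pointwise
    where
    g = extend (w ω)
    wf = w ω f
    gf≡wf : g (toℕ f) ≡ wf
    gf≡wf = extend-toℕ (w ω) f
    open Relative g (extend-w-nonNeg ω) (toℕ f) (subst (0ℚ ℚ.<_) (sym gf≡wf) (pos ω f))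
    relative≡ : ∀ x → relative (toℕ x) ≡ w ω x * inv₀ (intervalW ω f x) ²
    relative≡ x = cong₂ (λ a s → a * inv₀ s ²) (extend-toℕ (w ω) x) (sym (intervalW≡sumRange ω f x))
    ω′ : Weight n
    ω′ = record
      { w   = λ x → wf * relative (toℕ x)
      ; pos = λ x → subst (λ r → 0ℚ ℚ.< wf * r) (sym (relative≡ x))
                      (*-pos (pos ω f) (*-pos (pos ω x) (*-pos (inv₀-pos (intervalW-pos ω f x)) (inv₀-pos (intervalW-pos ω f x))))) }
    W′≤4 : totalW ω′ ℚ.≤ ℕtoℚ 4
    W′≤4 = begin
      totalW ω′                                 ≡⟨ sumℚ-allFin n (λ i → wf * relative i) ⟩
      sumFrom (λ i → wf * relative i) 0 n       ≡⟨ sym (*-distribˡ-sumFrom wf relative 0 n) ⟩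
      wf * sumFrom relative 0 n                 ≤⟨ *-monoˡ-≤-0≤ (ℚ.<⇒≤ (pos ω f)) (relative-total n (Fin.toℕ<n f)) ⟩
      wf * (i + (i + i))                        ≡⟨ solve 2 (λ a i → a :* (i :+ (i :+ i)) := a :* i :+ (a :* i :+ a :* i)) refl wf i ⟩
      wf * i + (wf * i + wf * i)                ≡⟨ cong (λ x → x + (x + x)) (trans (cong (λ a → wf * inv₀ a) gf≡wf) (*-inv₀ (pos ω f))) ⟩
      1ℚ + (1ℚ + 1ℚ)                            ≤⟨ toWitness {a? = 1ℚ + (1ℚ + 1ℚ) ℚ.≤? ℕtoℚ 4} _ ⟩
      ℕtoℚ 4                                    ∎
      where
      open ℚ.≤-Reasoning
      i = inv₀ (g (toℕ f))
    pointwise : ∀ s → powℚ (wf ℚ.⊓ w ω s) 2 ℚ.≤ powℚ (intervalW ω f s) 2 * (wf * relative (toℕ s))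
    pointwise s = begin
      powℚ (wf ℚ.⊓ ws) 2                        ≡⟨ cong ((wf ℚ.⊓ ws) *_) (ℚ.*-identityʳ _) ⟩
      (wf ℚ.⊓ ws) * (wf ℚ.⊓ ws)
        ≤⟨ *-mono-≤-0≤ (ℚ.<⇒≤ (pos ω f)) (ℚ.<⇒≤ (⊓-pos (pos ω f) (pos ω s))) (ℚ.p⊓q≤p wf ws) (ℚ.p⊓q≤q wf ws) ⟩
      wf * ws                                   ≡⟨ solve 2 (λ a b → a :* b := a :* b :* (con 1ℚ :* con 1ℚ)) refl wf ws ⟩
      wf * ws * (1ℚ * 1ℚ)                       ≡⟨ cong (λ x → wf * ws * (x * x)) (sym (*-inv₀ (intervalW-pos ω f s))) ⟩
      wf * ws * ((A * inv₀ A) * (A * inv₀ A))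
        ≡⟨ solve 4 (λ a b A i → a :* b :* ((A :* i) :* (A :* i)) := A :* (A :* con 1ℚ) :* (a :* (b :* (i :* i)))) refl wf ws A (inv₀ A) ⟩
      powℚ A 2 * (wf * (ws * inv₀ A ²))         ≡⟨ cong (λ r → powℚ A 2 * (wf * r)) (sym (relative≡ s)) ⟩
      powℚ A 2 * (wf * relative (toℕ s))        ∎
      where
      open ℚ.≤-Reasoning
      ws = w ω s
      A = intervalW ω f s

  ≼WB : ∀ B → bound B S ≼[ 1 , 0 ]⟨ m ⟩ WB S
  ≼WB wb  = ≼-refl (WB S)
  ≼WB so  = SO≼WB
  ≼WB wsf = WSF≼WB
  ≼WB ff  = ≼-trans (bound-positive ff) (bound-positive so) (bound-positive wb) FF≼SO SO≼WB

  WB≼ : ∀ B → WB S ≼[ 2 , 2 ]⟨ m ⟩ bound B S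
  WB≼ wb  = ≼-trans (bound-positive wb) (bound-positive ff) (bound-positive wb) WB≼FF (≼WB ff)
  WB≼ so  = ≼-trans (bound-positive wb) (bound-positive ff) (bound-positive so) WB≼FF FF≼SO
  WB≼ wsf = WB≼WSF
  WB≼ ff  = WB≼FF

  comparable : ∀ F G → bound F S ≤[ 2 , m ] bound G S
  comparable F G = ≼⇒≤ (bound-positive F) (bound-positive G)
    (≼-trans (bound-positive F) (bound-positive wb) (bound-positive G) (≼WB F) (WB≼ G))

mainTheorem6 : ∃[ c ] (∀ (n m : ℕ) (S : Vec (Fin n) m) → 1 ≤ n →
                 ∀ (F G : BoundName) →
                 bound F S ≤[ c , m ] bound G S)
mainTheorem6 = 2 , λ where
  (suc n′) m S _ → Comparisons.comparable S
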